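{- Let $F$ be a field of characteristic $p>0$, and let $A_1,\dots,A_n$ be finite additive subgroups of $F$. Assume that $f\in F[X_1,\dots,X_n]$ satisfies \[\deg(f)\leq(|A_1|-1)+\dots+(|A_n|-1)+(1-p^{ -1})\min\{|A_1|,\dots,|A_n|\}-1.\] If the coefficient of $X_1^{|A_1|-1}\cdots X_n^{|A_n|-1}$ in $f$ is zero, then \[\sum_{a\in A_1\times\dots\times A_n}f(a)=0.\]
   Context: $\deg(f)$ is the total degree. -}

module Defs where

open import Level using (Level; _⊔_)
open import Algebra.Bundles using (CommutativeRing)
open import Data.Nat as ℕ using (ℕ; zero; suc; _⊓_; _<_)
open import Data.Fin using (Fin; zero; suc)
open import Data.Vec as Vec using (Vec; []; _∷_)
open import Data.Vec.Properties using (≡-dec)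
open import Data.List as List using (List; []; _∷_; length; concatMap; map)
open import Data.Product using (Σ; _×_; _,_)
open import Relation.Nullary using (¬_; yes; no)
open import Relation.Binary.PropositionalEquality using (_≡_)
import Data.List.Membership.Setoid as SetoidMembership
import Data.List.Relation.Unary.Unique.Setoid as SetoidUnique

sumFin : (n : ℕ) → (Fin n → ℕ) → ℕ
sumFin zero    f = 0
sumFin (suc n) f = f zero ℕ.+ sumFin n (λ i → f (suc i))

-- Minimum of a function over Fin n (meaningful for n ≥ 1; value 0 for n = 0).
minFin : (n : ℕ) → (Fin n → ℕ) → ℕ
minFin zero          f = 0
minFin (suc zero)    f = f zero
minFin (suc (suc n)) f = f zero ⊓ minFin (suc n) (λ i → f (suc i))

totalDeg : {n : ℕ} → Vec ℕ n → ℕ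
totalDeg = Vec.foldr _ ℕ._+_ 0

module Poly {c ℓ : Level} (R : CommutativeRing c ℓ) where
  open CommutativeRing R renaming (Carrier to F)

  IsField : Set (c ⊔ ℓ)
  IsField = (¬ (1# ≈ 0#)) × (∀ x → ¬ (x ≈ 0#) → Σ F λ y → x * y ≈ 1#)

  natF : ℕ → F
  natF zero    = 0#
  natF (suc k) = 1# + natF k

  HasCharacteristic : ℕ → Set ℓ
  HasCharacteristic p = (natF p ≈ 0#) × (∀ k → 0 < k → k < p → ¬ (natF k ≈ 0#))

  open SetoidMembership setoid using (_∈_)
  open SetoidUnique setoid using (Unique)

  -- A finite additive subgroup of F, given by a duplicate-free (up to ≈) list of
  -- its elements; the subgroup is the set of elements ≈-equal to a list entry.
  record FiniteAdditiveSubgroup : Set (c ⊔ ℓ) where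
    field
      elems    : List F
      unique   : Unique elems
      has-zero : 0# ∈ elems
      +-closed : ∀ {x y} → x ∈ elems → y ∈ elems → (x + y) ∈ elems
      neg-closed : ∀ {x} → x ∈ elems → (- x) ∈ elems

  open FiniteAdditiveSubgroup public

  card : FiniteAdditiveSubgroup → ℕ
  card A = length (elems A)

  -- Polynomials in n variables: a finite formal sum of terms c·X^e, each term
  -- a coefficient together with an exponent vector (representation need not be
  -- normalised; the coefficient of a monomial sums all matching terms).
  Polynomial : ℕ → Set c
  Polynomial n = List (F × Vec ℕ n)

  sumF : List F → F
  sumF = List.foldr _+_ 0#

  coeff : {n : ℕ} → Polynomial n → Vec ℕ n → F
  coeff []             e = 0#
  coeff ((a , e') ∷ f) e with ≡-dec ℕ._≟_ e' e
  ... | yes _ = a + coeff f e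
  ... | no  _ = coeff f e

  -- deg f ≤ D  iff every monomial of total degree > D has coefficient zero.
  -- (Stated with a predicate "Ok" on degrees: deg f satisfies Ok when every
  -- monomial whose degree fails Ok has coefficient 0.)
  DegreeBounded : {n : ℕ} → Polynomial n → (ℕ → Set) → Set ℓ
  DegreeBounded f Ok = ∀ e → ¬ Ok (totalDeg e) → coeff f e ≈ 0#

  _^_ : F → ℕ → F
  x ^ zero  = 1#
  x ^ suc k = x * (x ^ k)

  monomialValue : {n : ℕ} → Vec ℕ n → Vec F n → F
  monomialValue []       []       = 1#
  monomialValue (k ∷ ks) (x ∷ xs) = (x ^ k) * monomialValue ks xs

  eval : {n : ℕ} → Polynomial n → Vec F n → F
  eval f x = sumF (map (λ { (a , e) → a * monomialValue e x }) f)

  points : {n : ℕ} → Vec (List F) n → List (Vec F n)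
  points []       = [] ∷ []
  points (L ∷ Ls) = concatMap (λ a → map (a ∷_) (points Ls)) L

  boxSum : {n : ℕ} → Polynomial n → (Fin n → FiniteAdditiveSubgroup) → F
  boxSum {n} f A = sumF (map (eval f) (points (Vec.tabulate (λ i → elems (A i)))))

-- Expanding f into monomials, the box sum is ∑ₑ cₑ ∏ᵢ Sᵢ(eᵢ) with power sums
-- Sᵢ(k) = ∑_{a ∈ Aᵢ} aᵏ, so it suffices that some Sᵢ(eᵢ) vanishes for every
-- monomial other than X^{|A|-1} allowed by the degree bound.
--
-- For an additive subgroup A of order q, S is invariant under translation by
-- b ∈ A; expanding (a + b)ᵏ turns this into a polynomial identity in b of
-- degree < q on q points, whence C(k,i) S(k-i) = 0 for 0 < i ≤ k as long as the
-- S(k-i) with i ≥ q vanish. The annihilator ∏_{a ∈ A} (X - a) is additive by the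
-- same argument, so C(q,j) = 0 for 0 < j < q: q is a power of p. Then
-- C(q-1,i) = ±1 gives S(j) = 0 for j < q - 1, and writing q = pQ, Lucas' theorem
-- makes C(2q-1-Q, i) nonzero for i ≤ q - 1 - Q, which gives S(j) = 0 for
-- q ≤ j < 2q - 1 - Q. The degree bound puts some exponent eᵢ ≠ qᵢ - 1 into one
-- of these two ranges.

module Submission where

open import Level using (Level)
open import Algebra.Bundles using (CommutativeRing)
open import Data.Nat as ℕ using (ℕ; zero; suc; _∸_; z≤n; s≤s)
import Data.Nat.Properties as ℕP
import Data.List.Properties as ListP
import Data.List.Relation.Unary.All.Properties as AllP
open import Data.Nat.Combinatorics using (_C_; nCk+nC[k+1]≡[n+1]C[k+1]; k>n⇒nCk≡0; nCn≡1; nC1≡n)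
open import Data.Integer as ℤ using (ℤ)
import Data.Integer.Properties as ℤP
open import Data.Sign as Sign using (Sign)
open import Data.Maybe using (Maybe; just; nothing)
open import Data.Fin using (Fin; zero; suc; toℕ)
import Data.Fin.Properties as FinP
open import Data.Vec as Vec using (Vec; []; _∷_)
import Data.Vec.Properties as VecP
open import Data.List as List using (List; []; _∷_)
open import Data.Product using (_,_; _×_; ∃; proj₁; proj₂)
open import Data.Sum using (_⊎_; inj₁; inj₂)
open import Data.Empty using (⊥-elim)
open import Data.Nat.DivMod using (_/_; _%_; m≡m%n+[m/n]*n; m%n<n)
open import Data.Nat.Divisibility using (_∣_; divides; m%n≡0⇒n∣m)
open import Relation.Nullary using (¬_; Dec; yes; no)
open import Relation.Binary.PropositionalEquality as P using (_≡_; _≢_)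
open import Defs

module Arithmetic where
  open import Data.Nat using (_+_; _*_; _≤_; _<_)
  import Algebra.Properties.CommutativeSemigroup ℕP.*-commutativeSemigroup as ℕ*
  import Algebra.Properties.CommutativeSemigroup ℕP.+-commutativeSemigroup as ℕ+

  [1+k]*[1+n]C[1+k]≡[1+n]*nCk : ∀ n k → suc k * (suc n C suc k) ≡ suc n * (n C k)
  [1+k]*[1+n]C[1+k]≡[1+n]*nCk zero    zero    = P.refl
  [1+k]*[1+n]C[1+k]≡[1+n]*nCk zero    (suc k) = ℕP.*-zeroʳ (suc (suc k))
  [1+k]*[1+n]C[1+k]≡[1+n]*nCk (suc n) zero    =
    P.trans (ℕP.*-identityˡ _) (P.trans (nC1≡n (suc (suc n))) (P.sym (ℕP.*-identityʳ (suc (suc n)))))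
  [1+k]*[1+n]C[1+k]≡[1+n]*nCk (suc n) (suc k) = begin
    suc (suc k) * (m+1 C suc (suc k))
      ≡⟨ P.cong (suc (suc k) *_) (P.sym (nCk+nC[k+1]≡[n+1]C[k+1] m (suc k))) ⟩
    suc (suc k) * (m C suc k + m C suc (suc k))
      ≡⟨ ℕP.*-distribˡ-+ (suc (suc k)) (m C suc k) _ ⟩
    (m C suc k + suc k * (m C suc k)) + suc (suc k) * (m C suc (suc k))
      ≡⟨ P.cong₂ (λ a b → (m C suc k + a) + b) ([1+k]*[1+n]C[1+k]≡[1+n]*nCk n k) ([1+k]*[1+n]C[1+k]≡[1+n]*nCk n (suc k)) ⟩
    (m C suc k + m * (n C k)) + m * (n C suc k)
      ≡⟨ ℕP.+-assoc (m C suc k) _ _ ⟩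
    m C suc k + (m * (n C k) + m * (n C suc k))
      ≡⟨ P.cong (m C suc k +_) (P.sym (ℕP.*-distribˡ-+ m (n C k) _)) ⟩
    m C suc k + m * (n C k + n C suc k)
      ≡⟨ P.cong (λ a → m C suc k + m * a) (nCk+nC[k+1]≡[n+1]C[k+1] n k) ⟩
    m+1 * (m C suc k) ∎
    where
    open P.≡-Reasoning
    m = suc n
    m+1 = suc m

  digit-bound : ∀ {p Q q′ x u r} → x + Q ≡ q′ → suc q′ ≡ Q * p → u * Q + r ≤ x → suc u * Q < p * Q
  digit-bound {p} {Q} {q′} {x} {u} {r} x+Q≡q′ q≡Qp uQ+r≤x = begin-strict
    Q + u * Q          ≤⟨ ℕP.+-monoʳ-≤ Q (ℕP.m≤m+n (u * Q) r) ⟩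
    Q + (u * Q + r)    ≤⟨ ℕP.+-monoʳ-≤ Q uQ+r≤x ⟩
    Q + x              ≡⟨ P.trans (ℕP.+-comm Q x) x+Q≡q′ ⟩
    q′                 <⟨ ℕP.n<1+n q′ ⟩
    suc q′             ≡⟨ P.trans q≡Qp (ℕP.*-comm Q p) ⟩
    p * Q              ∎
    where open ℕP.≤-Reasoning

  gap-bound : ∀ {p′ Q q′ x j} → suc q′ ≡ Q * suc p′ → x + Q ≡ q′ → suc q′ ≤ j →
              suc p′ * (j ∸ q′) + suc p′ ≤ p′ * suc q′ → j < x + suc q′
  gap-bound {p′} {Q} {q′} {x} {j} q≡Qp x+Q≡q′ q≤j bound = begin
    suc j              ≡⟨ P.cong suc (P.sym (ℕP.m+[n∸m]≡n q′≤j)) ⟩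
    suc (q′ + d)       ≡⟨ P.sym (ℕP.+-suc q′ d) ⟩
    q′ + suc d         ≤⟨ ℕP.+-monoʳ-≤ q′ 1+d≤p′Q ⟩
    q′ + p′ * Q        ≡⟨ P.cong (_+ p′ * Q) (P.sym x+Q≡q′) ⟩
    x + Q + p′ * Q     ≡⟨ ℕP.+-assoc x Q (p′ * Q) ⟩
    x + suc p′ * Q     ≡⟨ P.cong (x +_) (P.trans (ℕP.*-comm (suc p′) Q) (P.sym q≡Qp)) ⟩
    x + suc q′         ∎
    where
    open ℕP.≤-Reasoning
    p = suc p′
    d = j ∸ q′
    q′≤j = ℕP.≤-trans (ℕP.n≤1+n q′) q≤j
    1+d≤p′Q : suc d ≤ p′ * Q
    1+d≤p′Q = ℕP.*-cancelˡ-≤ p (begin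
      p * suc d        ≡⟨ P.trans (ℕP.*-suc p d) (ℕP.+-comm p (p * d)) ⟩
      p * d + p        ≤⟨ bound ⟩
      p′ * suc q′      ≡⟨ P.cong (p′ *_) q≡Qp ⟩
      p′ * (Q * p)     ≡⟨ P.trans (P.cong (p′ *_) (ℕP.*-comm Q p)) (ℕ*.x∙yz≈y∙xz p′ p Q) ⟩
      p * (p′ * Q)     ∎)

  totalDeg≡sumFin : ∀ {n} (e : Vec ℕ n) → totalDeg e ≡ sumFin n (Vec.lookup e)
  totalDeg≡sumFin []      = P.refl
  totalDeg≡sumFin (k ∷ e) = P.cong (k +_) (totalDeg≡sumFin e)

  sumFin-mono : ∀ n {s t : Fin n → ℕ} → (∀ i → s i ≤ t i) → sumFin n s ≤ sumFin n t
  sumFin-mono zero    s≤t = z≤n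
  sumFin-mono (suc n) s≤t = ℕP.+-mono-≤ (s≤t zero) (sumFin-mono n (λ i → s≤t (suc i)))

  sumFin-excess : ∀ n {s t : Fin n → ℕ} → (∀ i → s i ≤ t i) → ∀ i → sumFin n s + (t i ∸ s i) ≤ sumFin n t
  sumFin-excess (suc n) {s} {t} s≤t zero = begin
    (s zero + Σs) + (t zero ∸ s zero)     ≡⟨ ℕ+.xy∙z≈xz∙y (s zero) Σs _ ⟩
    (s zero + (t zero ∸ s zero)) + Σs     ≡⟨ P.cong (_+ Σs) (ℕP.m+[n∸m]≡n (s≤t zero)) ⟩
    t zero + Σs                           ≤⟨ ℕP.+-monoʳ-≤ (t zero) (sumFin-mono n (λ i → s≤t (suc i))) ⟩
    t zero + sumFin n (λ i → t (suc i))   ∎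
    where
    open ℕP.≤-Reasoning
    Σs = sumFin n (λ i → s (suc i))
  sumFin-excess (suc n) {s} {t} s≤t (suc i) = begin
    (s zero + Σs) + (t (suc i) ∸ s (suc i))   ≡⟨ ℕP.+-assoc (s zero) Σs _ ⟩
    s zero + (Σs + (t (suc i) ∸ s (suc i)))   ≤⟨ ℕP.+-mono-≤ (s≤t zero) (sumFin-excess n (λ j → s≤t (suc j)) i) ⟩
    t zero + sumFin n (λ j → t (suc j))       ∎
    where
    open ℕP.≤-Reasoning
    Σs = sumFin n (λ j → s (suc j))

  minFin≤ : ∀ n (d : Fin n → ℕ) i → minFin n d ≤ d i
  minFin≤ (suc zero)    d zero    = ℕP.≤-refl
  minFin≤ (suc (suc n)) d zero    = ℕP.m⊓n≤m (d zero) _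
  minFin≤ (suc (suc n)) d (suc i) = ℕP.≤-trans (ℕP.m⊓n≤n (d zero) _) (minFin≤ (suc n) (λ j → d (suc j)) i)

  exponent-trichotomy : ∀ {n} (e : Vec ℕ n) (t : Fin n → ℕ) →
                        e ≡ Vec.tabulate t ⊎ (∃ λ i → Vec.lookup e i < t i)
                                           ⊎ ((∀ j → t j ≤ Vec.lookup e j) × ∃ λ i → t i < Vec.lookup e i)
  exponent-trichotomy {n} e t with FinP.any? (λ i → Vec.lookup e i ℕ.<? t i)
  ... | yes below = inj₂ (inj₁ below)
  ... | no ¬below with FinP.all? (λ i → Vec.lookup e i ℕ.≟ t i)
  ...   | yes e≗t = inj₁ (P.trans (P.sym (VecP.tabulate∘lookup e)) (VecP.tabulate-cong e≗t))
  ...   | no e≉t  = inj₂ (inj₂ (t≤e , i , ℕP.≤∧≢⇒< (t≤e i) (λ t≡e → e≢t (P.sym t≡e))))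
    where
    t≤e : ∀ j → t j ≤ Vec.lookup e j
    t≤e j = ℕP.≮⇒≥ (λ e<t → ¬below (j , e<t))
    i = proj₁ (FinP.¬∀⟶∃¬ n _ (λ i → Vec.lookup e i ℕ.≟ t i) e≉t)
    e≢t = proj₂ (FinP.¬∀⟶∃¬ n _ (λ i → Vec.lookup e i ℕ.≟ t i) e≉t)

  excess-bound : ∀ p′ Σ D m d qi → suc p′ * D + suc p′ ≤ suc p′ * Σ + p′ * m →
                 Σ + d ≤ D → m ≤ qi → suc p′ * d + suc p′ ≤ p′ * qi
  excess-bound p′ Σ D m d qi deg Σ+d≤D m≤qi = ℕP.+-cancelˡ-≤ (p * Σ) _ _ (begin
    p * Σ + (p * d + p)   ≡⟨ P.sym (ℕP.+-assoc (p * Σ) (p * d) p) ⟩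
    p * Σ + p * d + p     ≡⟨ P.cong (_+ p) (P.sym (ℕP.*-distribˡ-+ p Σ d)) ⟩
    p * (Σ + d) + p       ≤⟨ ℕP.+-monoˡ-≤ p (ℕP.*-monoʳ-≤ p Σ+d≤D) ⟩
    p * D + p             ≤⟨ deg ⟩
    p * Σ + p′ * m        ≤⟨ ℕP.+-monoʳ-≤ (p * Σ) (ℕP.*-monoʳ-≤ p′ m≤qi) ⟩
    p * Σ + p′ * qi       ∎)
    where
    open ℕP.≤-Reasoning
    p = suc p′

open Arithmetic

open import Algebra.Solver.Ring.AlmostCommutativeRing
  using (fromCommutativeRing; _-Raw-AlmostCommutative⟶_)
import Algebra.Solver.Ring as RingSolver

module RingArithmetic {c ℓ : Level} (R : CommutativeRing c ℓ) where
  open CommutativeRing R renaming (Carrier to F) public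
  open Poly R public
  open import Algebra.Properties.Ring ring public
  open import Algebra.Properties.CommutativeSemigroup +-commutativeSemigroup public
    using () renaming (interchange to +-interchange; x∙yz≈y∙xz to x+[y+z]≈y+[x+z])
  open import Algebra.Properties.CommutativeSemigroup *-commutativeSemigroup public
    using () renaming (interchange to *-interchange; x∙yz≈y∙xz to x*[y*z]≈y*[x*z])
  open import Relation.Binary.Reasoning.Setoid setoid public
  open import Algebra.Properties.Monoid.Mult +-monoid using (×-homo-+) renaming (_×_ to _·_)
  open import Algebra.Properties.Semiring.Mult semiring using (×1-homo-*)

  natF≡·1# : ∀ n → natF n ≡ n · 1#
  natF≡·1# zero    = P.refl
  natF≡·1# (suc n) = P.cong (1# +_) (natF≡·1# n)

  natF-+ : ∀ m n → natF (m ℕ.+ n) ≈ natF m + natF n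
  natF-+ m n rewrite natF≡·1# (m ℕ.+ n) | natF≡·1# m | natF≡·1# n = ×-homo-+ 1# m n

  natF-* : ∀ m n → natF (m ℕ.* n) ≈ natF m * natF n
  natF-* m n rewrite natF≡·1# (m ℕ.* n) | natF≡·1# m | natF≡·1# n = ×1-homo-* m n

  natF-· : ∀ n x → n · x ≈ natF n * x
  natF-· zero    x = sym (zeroˡ x)
  natF-· (suc n) x = begin
    x + n · x              ≈⟨ +-cong (sym (*-identityˡ x)) (natF-· n x) ⟩
    1# * x + natF n * x    ≈⟨ sym (distribʳ x 1# (natF n)) ⟩
    (1# + natF n) * x      ∎

  x≈0⇒xy≈0 : ∀ {x y} → x ≈ 0# → x * y ≈ 0#
  x≈0⇒xy≈0 {y = y} x≈0 = trans (*-congʳ x≈0) (zeroˡ y)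

  y≈0⇒xy≈0 : ∀ {x y} → y ≈ 0# → x * y ≈ 0#
  y≈0⇒xy≈0 {x} y≈0 = trans (*-congˡ y≈0) (zeroʳ x)

  x-0≈x : ∀ x → x - 0# ≈ x
  x-0≈x x = trans (+-congˡ -0#≈0#) (+-identityʳ x)

  -- Integers act on F through natF; this homomorphism lets the ring solver
  -- normalise coefficients, which it cannot do with coefficients in F.
  module IntegerSolver where
    ⟦_⟧ℤ : ℤ → F
    ⟦ ℤ.+ n ⟧ℤ      = natF n
    ⟦ ℤ.-[1+ n ] ⟧ℤ = - natF (suc n)

    signF : Sign → F
    signF Sign.+ = 1#
    signF Sign.- = - 1#

    ⊖-homo : ∀ m n → ⟦ m ℤ.⊖ n ⟧ℤ ≈ natF m - natF n
    ⊖-homo m       zero    = sym (x-0≈x _)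
    ⊖-homo zero    (suc n) = sym (+-identityˡ _)
    ⊖-homo (suc m) (suc n) = begin
      ⟦ suc m ℤ.⊖ suc n ⟧ℤ                   ≡⟨ P.cong ⟦_⟧ℤ (ℤP.[1+m]⊖[1+n]≡m⊖n m n) ⟩
      ⟦ m ℤ.⊖ n ⟧ℤ                           ≈⟨ ⊖-homo m n ⟩
      natF m - natF n                        ≈⟨ sym (+-identityˡ _) ⟩
      0# + (natF m - natF n)                 ≈⟨ +-congʳ (sym (-‿inverseʳ 1#)) ⟩
      (1# - 1#) + (natF m - natF n)          ≈⟨ +-interchange 1# (- 1#) (natF m) (- natF n) ⟩
      (1# + natF m) + (- 1# + - natF n)      ≈⟨ +-congˡ (-‿+-comm 1# (natF n)) ⟩
      natF (suc m) - natF (suc n)            ∎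

    +-homo : ∀ i j → ⟦ i ℤ.+ j ⟧ℤ ≈ ⟦ i ⟧ℤ + ⟦ j ⟧ℤ
    +-homo ℤ.-[1+ m ] ℤ.-[1+ n ] = begin
      - (1# + natF (suc m ℕ.+ n))            ≈⟨ -‿cong (+-congˡ (natF-+ (suc m) n)) ⟩
      - (1# + (natF (suc m) + natF n))       ≈⟨ -‿cong (x+[y+z]≈y+[x+z] 1# (natF (suc m)) (natF n)) ⟩
      - (natF (suc m) + (1# + natF n))       ≈⟨ sym (-‿+-comm _ _) ⟩
      - natF (suc m) + - natF (suc n)        ∎
    +-homo ℤ.-[1+ m ] (ℤ.+ n)    = trans (⊖-homo n (suc m)) (+-comm _ _)
    +-homo (ℤ.+ m)    ℤ.-[1+ n ] = ⊖-homo m (suc n)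
    +-homo (ℤ.+ m)    (ℤ.+ n)    = natF-+ m n

    -‿homo : ∀ i → ⟦ ℤ.- i ⟧ℤ ≈ - ⟦ i ⟧ℤ
    -‿homo ℤ.-[1+ n ]    = sym (-‿involutive _)
    -‿homo (ℤ.+ zero)    = sym -0#≈0#
    -‿homo (ℤ.+ suc n)   = refl

    ◃-homo : ∀ s n → ⟦ s ℤ.◃ n ⟧ℤ ≈ signF s * natF n
    ◃-homo s       zero    = sym (zeroʳ _)
    ◃-homo Sign.+  (suc n) = sym (*-identityˡ _)
    ◃-homo Sign.-  (suc n) = sym (-1*x≈-x _)

    sign-abs : ∀ i → ⟦ i ⟧ℤ ≈ signF (ℤ.sign i) * natF ℤ.∣ i ∣
    sign-abs ℤ.-[1+ n ] = sym (-1*x≈-x _)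
    sign-abs (ℤ.+ n)    = sym (*-identityˡ _)

    signF-* : ∀ s t → signF (s Sign.* t) ≈ signF s * signF t
    signF-* Sign.- Sign.- = sym (trans (-1*x≈-x _) (-‿involutive _))
    signF-* Sign.- Sign.+ = sym (*-identityʳ _)
    signF-* Sign.+ Sign.- = sym (*-identityˡ _)
    signF-* Sign.+ Sign.+ = sym (*-identityˡ _)

    *-homo : ∀ i j → ⟦ i ℤ.* j ⟧ℤ ≈ ⟦ i ⟧ℤ * ⟦ j ⟧ℤ
    *-homo i j = begin
      ⟦ (s Sign.* t) ℤ.◃ (∣i∣ ℕ.* ∣j∣) ⟧ℤ              ≈⟨ ◃-homo (s Sign.* t) (∣i∣ ℕ.* ∣j∣) ⟩
      signF (s Sign.* t) * natF (∣i∣ ℕ.* ∣j∣)          ≈⟨ *-cong (signF-* s t) (natF-* ∣i∣ ∣j∣) ⟩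
      (signF s * signF t) * (natF ∣i∣ * natF ∣j∣)     ≈⟨ *-interchange _ _ _ _ ⟩
      (signF s * natF ∣i∣) * (signF t * natF ∣j∣)     ≈⟨ sym (*-cong (sign-abs i) (sign-abs j)) ⟩
      ⟦ i ⟧ℤ * ⟦ j ⟧ℤ                                  ∎
      where
      s = ℤ.sign i
      t = ℤ.sign j
      ∣i∣ = ℤ.∣ i ∣
      ∣j∣ = ℤ.∣ j ∣

    ℤ⟶F : ℤ.+-*-rawRing -Raw-AlmostCommutative⟶ fromCommutativeRing R
    ℤ⟶F = record
      { ⟦_⟧ = ⟦_⟧ℤ ; +-homo = +-homo ; *-homo = *-homo ; -‿homo = -‿homo
      ; 0-homo = refl ; 1-homo = +-identityʳ 1# }

    ⟦⟧ℤ-≟ : ∀ i j → Maybe (⟦ i ⟧ℤ ≈ ⟦ j ⟧ℤ)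
    ⟦⟧ℤ-≟ i j with i ℤ.≟ j
    ... | yes P.refl = just refl
    ... | no _       = nothing

    open RingSolver ℤ.+-*-rawRing (fromCommutativeRing R) ℤ⟶F ⟦⟧ℤ-≟ public
      using (solve; _:+_; _:*_; _:-_; _:=_)

module FiniteSums {c ℓ : Level} (R : CommutativeRing c ℓ) where
  open RingArithmetic R
  open import Data.List.Membership.Setoid setoid using (_∈_; _─_)
  open import Data.List.Membership.Setoid.Properties using (All[≉]⇒∉; ∈-resp-≈)
  open import Data.List.Relation.Unary.Unique.Setoid setoid using (Unique)
  open import Data.List.Relation.Unary.Any as Any using (here; there)
  open import Data.List.Relation.Unary.AllPairs.Core using ([]; _∷_)

  sumBelow : ℕ → (ℕ → F) → F
  sumBelow zero    f = 0#
  sumBelow (suc n) f = f 0 + sumBelow n (λ i → f (suc i))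

  syntax sumBelow n (λ i → e) = ∑[ i < n ] e

  sumList : ∀ {a} {A : Set a} → List A → (A → F) → F
  sumList xs g = sumF (List.map g xs)

  syntax sumList xs (λ x → e) = ∑[ x ← xs ] e

  productList : ∀ {a} {A : Set a} → List A → (A → F) → F
  productList xs g = List.foldr _*_ 1# (List.map g xs)

  syntax productList xs (λ x → e) = ∏[ x ← xs ] e

  sumBelow-cong : ∀ n {f g : ℕ → F} → (∀ i → i ℕ.< n → f i ≈ g i) → sumBelow n f ≈ sumBelow n g
  sumBelow-cong zero    f≈g = refl
  sumBelow-cong (suc n) f≈g = +-cong (f≈g 0 (s≤s z≤n)) (sumBelow-cong n (λ i i<n → f≈g (suc i) (s≤s i<n)))

  sumBelow-zero : ∀ n {f : ℕ → F} → (∀ i → i ℕ.< n → f i ≈ 0#) → sumBelow n f ≈ 0#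
  sumBelow-zero zero    f≈0 = refl
  sumBelow-zero (suc n) f≈0 =
    trans (+-cong (f≈0 0 (s≤s z≤n)) (sumBelow-zero n (λ i i<n → f≈0 (suc i) (s≤s i<n)))) (+-identityˡ 0#)

  sumBelow-+ : ∀ n (f g : ℕ → F) → ∑[ i < n ] (f i + g i) ≈ sumBelow n f + sumBelow n g
  sumBelow-+ zero    f g = sym (+-identityˡ 0#)
  sumBelow-+ (suc n) f g = trans (+-congˡ (sumBelow-+ n _ _)) (+-interchange _ _ _ _)

  sumBelow-*ˡ : ∀ n a (f : ℕ → F) → a * sumBelow n f ≈ ∑[ i < n ] (a * f i)
  sumBelow-*ˡ zero    a f = zeroʳ a
  sumBelow-*ˡ (suc n) a f = trans (distribˡ _ _ _) (+-congˡ (sumBelow-*ˡ n a _))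

  sumBelow-*ʳ : ∀ n a (f : ℕ → F) → sumBelow n f * a ≈ ∑[ i < n ] (f i * a)
  sumBelow-*ʳ n a f = trans (*-comm _ _) (trans (sumBelow-*ˡ n a f) (sumBelow-cong n (λ i _ → *-comm _ _)))

  sumBelow-neg : ∀ n (f : ℕ → F) → - sumBelow n f ≈ ∑[ i < n ] (- f i)
  sumBelow-neg zero    f = -0#≈0#
  sumBelow-neg (suc n) f = trans (sym (-‿+-comm _ _)) (+-congˡ (sumBelow-neg n _))

  sumBelow-- : ∀ n (f g : ℕ → F) → ∑[ i < n ] (f i - g i) ≈ sumBelow n f - sumBelow n g
  sumBelow-- n f g = trans (sumBelow-+ n f (λ i → - g i)) (+-congˡ (sym (sumBelow-neg n g)))

  sumBelow-last : ∀ n (f : ℕ → F) → sumBelow (suc n) f ≈ sumBelow n f + f n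
  sumBelow-last zero    f = trans (+-identityʳ _) (sym (+-identityˡ _))
  sumBelow-last (suc n) f = trans (+-congˡ (sumBelow-last n _)) (sym (+-assoc _ _ _))

  sumBelow-split : ∀ m n (f : ℕ → F) → sumBelow (m ℕ.+ n) f ≈ sumBelow m f + ∑[ i < n ] f (m ℕ.+ i)
  sumBelow-split zero    n f = sym (+-identityˡ _)
  sumBelow-split (suc m) n f = trans (+-congˡ (sumBelow-split m n _)) (sym (+-assoc _ _ _))

  sumBelow-swap : ∀ m n (f : ℕ → ℕ → F) → ∑[ i < m ] ∑[ j < n ] f i j ≈ ∑[ j < n ] ∑[ i < m ] f i j
  sumBelow-swap zero    n f = sym (sumBelow-zero n (λ _ _ → refl))
  sumBelow-swap (suc m) n f = trans (+-congˡ (sumBelow-swap m n _)) (sym (sumBelow-+ n _ _))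

  sumBelow-extend : ∀ m n (f : ℕ → F) → m ℕ.≤ n → (∀ i → m ℕ.≤ i → f i ≈ 0#) → sumBelow n f ≈ sumBelow m f
  sumBelow-extend m n f m≤n f≈0 with ℕP.m≤n⇒∃[o]m+o≡n m≤n
  ... | k , P.refl = begin
    sumBelow (m ℕ.+ k) f                   ≈⟨ sumBelow-split m k f ⟩
    sumBelow m f + ∑[ i < k ] f (m ℕ.+ i)  ≈⟨ +-congˡ (sumBelow-zero k (λ i _ → f≈0 (m ℕ.+ i) (ℕP.m≤m+n m i))) ⟩
    sumBelow m f + 0#                      ≈⟨ +-identityʳ _ ⟩
    sumBelow m f                           ∎

  private
    variable
      a b : Level
      A : Set a
      B : Set b

  sumList-cong : ∀ (xs : List A) {g h : A → F} → (∀ x → g x ≈ h x) → sumList xs g ≈ sumList xs h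
  sumList-cong []       g≈h = refl
  sumList-cong (x ∷ xs) g≈h = +-cong (g≈h x) (sumList-cong xs g≈h)

  sumList-zero : ∀ (xs : List A) {g : A → F} → (∀ x → g x ≈ 0#) → sumList xs g ≈ 0#
  sumList-zero []       g≈0 = refl
  sumList-zero (x ∷ xs) g≈0 = trans (+-cong (g≈0 x) (sumList-zero xs g≈0)) (+-identityˡ 0#)

  sumList-+ : ∀ (xs : List A) (g h : A → F) → ∑[ x ← xs ] (g x + h x) ≈ sumList xs g + sumList xs h
  sumList-+ []       g h = sym (+-identityˡ 0#)
  sumList-+ (x ∷ xs) g h = trans (+-congˡ (sumList-+ xs g h)) (+-interchange _ _ _ _)

  sumList-*ˡ : ∀ (xs : List A) a (g : A → F) → a * sumList xs g ≈ ∑[ x ← xs ] (a * g x)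
  sumList-*ˡ []       a g = zeroʳ a
  sumList-*ˡ (x ∷ xs) a g = trans (distribˡ _ _ _) (+-congˡ (sumList-*ˡ xs a g))

  sumList-*ʳ : ∀ (xs : List A) a (g : A → F) → sumList xs g * a ≈ ∑[ x ← xs ] (g x * a)
  sumList-*ʳ xs a g = trans (*-comm _ _) (trans (sumList-*ˡ xs a g) (sumList-cong xs (λ _ → *-comm _ _)))

  sumList-sumBelow : ∀ (xs : List A) n (g : A → ℕ → F) → ∑[ x ← xs ] ∑[ i < n ] g x i ≈ ∑[ i < n ] ∑[ x ← xs ] g x i
  sumList-sumBelow []       n g = sym (sumBelow-zero n (λ _ _ → refl))
  sumList-sumBelow (x ∷ xs) n g = trans (+-congˡ (sumList-sumBelow xs n g)) (sym (sumBelow-+ n _ _))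

  sumList-++ : ∀ (xs ys : List A) (g : A → F) → sumList (xs List.++ ys) g ≈ sumList xs g + sumList ys g
  sumList-++ []       ys g = sym (+-identityˡ _)
  sumList-++ (x ∷ xs) ys g = trans (+-congˡ (sumList-++ xs ys g)) (sym (+-assoc _ _ _))

  sumList-swap : ∀ (xs : List A) (ys : List B) (g : A → B → F) →
                 ∑[ x ← xs ] ∑[ y ← ys ] g x y ≈ ∑[ y ← ys ] ∑[ x ← xs ] g x y
  sumList-swap []       ys g = sym (sumList-zero ys (λ _ → refl))
  sumList-swap (x ∷ xs) ys g = trans (+-congˡ (sumList-swap xs ys g)) (sym (sumList-+ ys _ _))

  sumList-map : ∀ (xs : List A) (h : A → B) (g : B → F) → sumList (List.map h xs) g ≈ ∑[ x ← xs ] g (h x)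
  sumList-map []       h g = refl
  sumList-map (x ∷ xs) h g = +-congˡ (sumList-map xs h g)

  sumList-concatMap : ∀ (xs : List A) (h : A → List B) (g : B → F) →
                      sumList (List.concatMap h xs) g ≈ ∑[ x ← xs ] sumList (h x) g
  sumList-concatMap []       h g = refl
  sumList-concatMap (x ∷ xs) h g = trans (sumList-++ (h x) _ g) (+-congˡ (sumList-concatMap xs h g))

  module _ {g : F → F} (g-cong : ∀ {x y} → x ≈ y → g x ≈ g y) where
    sumList-─ : ∀ {x} ys (x∈ys : x ∈ ys) → sumList ys g ≈ g x + sumList (ys ─ x∈ys) g
    sumList-─ (y ∷ ys) (here x≈y)  = +-congʳ (g-cong (sym x≈y))
    sumList-─ (y ∷ ys) (there x∈ys) = trans (+-congˡ (sumList-─ ys x∈ys)) (x+[y+z]≈y+[x+z] _ _ _)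

    -- The hypotheses make ys a rearrangement of xs.
    sumList-⊆ : ∀ {xs ys} → Unique xs → (∀ {x} → x ∈ xs → x ∈ ys) → List.length xs ≡ List.length ys →
                sumList xs g ≈ sumList ys g
    sumList-⊆ {[]}     {[]} _            _     _         = refl
    sumList-⊆ {x ∷ xs} {ys} (x∉xs ∷ xs!) xs⊆ys |xs|≡|ys| = begin
      g x + sumList xs g                ≈⟨ +-congˡ (sumList-⊆ xs! xs⊆ys─x |xs|≡|ys─x|) ⟩
      g x + sumList (ys ─ x∈ys) g       ≈⟨ sym (sumList-─ ys x∈ys) ⟩
      sumList ys g                      ∎
      where
      x∈ys = xs⊆ys (here refl)
      xs⊆ys─x : ∀ {y} → y ∈ xs → y ∈ ys ─ x∈ys
      xs⊆ys─x {y} y∈xs = ∈-─ ys x∈ys (xs⊆ys (there y∈xs)) (λ y≈x → All[≉]⇒∉ setoid x∉xs (∈-resp-≈ setoid y≈x y∈xs))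
        where
        ∈-─ : ∀ ys (x∈ys : x ∈ ys) → y ∈ ys → ¬ (y ≈ x) → y ∈ ys ─ x∈ys
        ∈-─ (z ∷ ys) (here x≈z)  (here y≈z)  y≉x = ⊥-elim (y≉x (trans y≈z (sym x≈z)))
        ∈-─ (z ∷ ys) (here x≈z)  (there y∈ys) y≉x = y∈ys
        ∈-─ (z ∷ ys) (there x∈ys) (here y≈z)  y≉x = here y≈z
        ∈-─ (z ∷ ys) (there x∈ys) (there y∈ys) y≉x = there (∈-─ ys x∈ys y∈ys y≉x)
      |xs|≡|ys─x| : List.length xs ≡ List.length (ys ─ x∈ys)
      |xs|≡|ys─x| = ℕP.suc-injective (P.trans |xs|≡|ys| (ListP.length-removeAt′ ys (Any.index x∈ys)))

module Binomials {c ℓ : Level} (R : CommutativeRing c ℓ) where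
  open RingArithmetic R
  open FiniteSums R
  open import Algebra.Properties.Semiring.Exp semiring using () renaming (_^_ to _^ᴹ_)
  import Algebra.Properties.Monoid.Sum +-monoid as MonoidSum
  import Algebra.Properties.CommutativeSemiring.Binomial commutativeSemiring as Binomial
  open import Algebra.Properties.Monoid.Mult +-monoid using () renaming (_×_ to _·_)

  ^-cong : ∀ {x y} n → x ≈ y → x ^ n ≈ y ^ n
  ^-cong zero    x≈y = refl
  ^-cong (suc n) x≈y = *-cong x≈y (^-cong n x≈y)

  ^-+ : ∀ x m n → x ^ (m ℕ.+ n) ≈ x ^ m * x ^ n
  ^-+ x zero    n = sym (*-identityˡ _)
  ^-+ x (suc m) n = trans (*-congˡ (^-+ x m n)) (sym (*-assoc _ _ _))

  bin : ℕ → ℕ → F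
  bin n k = natF (n C k)

  bin-pascal : ∀ n k → bin (suc n) (suc k) ≈ bin n k + bin n (suc k)
  bin-pascal n k = trans (reflexive (P.cong natF (P.sym (nCk+nC[k+1]≡[n+1]C[k+1] n k)))) (natF-+ (n C k) _)

  bin-0 : ∀ n → bin n 0 ≈ 1#
  bin-0 n = +-identityʳ 1#

  bin-diag : ∀ n → bin n n ≈ 1#
  bin-diag n = trans (reflexive (P.cong natF (nCn≡1 n))) (+-identityʳ 1#)

  bin-> : ∀ n k → n ℕ.< k → bin n k ≈ 0#
  bin-> n k n<k = reflexive (P.cong natF (k>n⇒nCk≡0 n<k))

  binomial-theorem : ∀ x y n → (x + y) ^ n ≈ ∑[ i < suc n ] (bin n i * (x ^ i * y ^ (n ∸ i)))
  binomial-theorem x y n = begin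
    (x + y) ^ n
      ≡⟨ ^≡^ᴹ (x + y) n ⟩
    (x + y) ^ᴹ n
      ≈⟨ Binomial.theorem n x y ⟩
    MonoidSum.sum {suc n} (λ i → term (toℕ i))
      ≈⟨ reflexive (sum≡sumBelow (suc n) term) ⟩
    ∑[ i < suc n ] term i
      ≈⟨ sumBelow-cong (suc n) (λ i _ → natF-· (n C i) (x ^ᴹ i * y ^ᴹ (n ∸ i))) ⟩
    ∑[ i < suc n ] (bin n i * (x ^ᴹ i * y ^ᴹ (n ∸ i)))
      ≈⟨ sumBelow-cong (suc n) (λ i _ → reflexive (P.sym (^-bridge i))) ⟩
    ∑[ i < suc n ] (bin n i * (x ^ i * y ^ (n ∸ i))) ∎
    where
    term : ℕ → F
    term i = (n C i) · (x ^ᴹ i * y ^ᴹ (n ∸ i))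
    ^≡^ᴹ : ∀ z k → z ^ k ≡ z ^ᴹ k
    ^≡^ᴹ z zero    = P.refl
    ^≡^ᴹ z (suc k) = P.cong (z *_) (^≡^ᴹ z k)
    ^-bridge : ∀ i → bin n i * (x ^ i * y ^ (n ∸ i)) ≡ bin n i * (x ^ᴹ i * y ^ᴹ (n ∸ i))
    ^-bridge i = P.cong₂ (λ u v → bin n i * (u * v)) (^≡^ᴹ x i) (^≡^ᴹ y (n ∸ i))
    sum≡sumBelow : ∀ m (f : ℕ → F) → MonoidSum.sum {m} (λ i → f (toℕ i)) ≡ sumBelow m f
    sum≡sumBelow zero    f = P.refl
    sum≡sumBelow (suc m) f = P.cong (f 0 +_) (sum≡sumBelow m (λ i → f (suc i)))

-- G is a Frobenius exponent when (x + y)^G = x^G + y^G identically, i.e. when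
-- the inner binomial coefficients of G vanish; in characteristic p these G
-- are exactly the powers of p.
module FrobeniusExponents {c ℓ : Level} (R : CommutativeRing c ℓ) where
  open RingArithmetic R
  open Binomials R

  FrobeniusExponent : ℕ → Set ℓ
  FrobeniusExponent G = ∀ t → 0 ℕ.< t → t ℕ.< G → bin G t ≈ 0#

  module _ {G : ℕ} (frob : FrobeniusExponent G) where
    bin-+-frob-< : ∀ n i → i ℕ.< G → bin (n ℕ.+ G) i ≈ bin n i
    bin-+-frob-< zero    zero    i<G = refl
    bin-+-frob-< zero    (suc i) i<G = frob (suc i) (s≤s z≤n) i<G
    bin-+-frob-< (suc n) zero    i<G = refl
    bin-+-frob-< (suc n) (suc i) i<G = begin
      bin (suc n ℕ.+ G) (suc i)
        ≈⟨ bin-pascal (n ℕ.+ G) i ⟩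
      bin (n ℕ.+ G) i + bin (n ℕ.+ G) (suc i)
        ≈⟨ +-cong (bin-+-frob-< n i (ℕP.<-trans (ℕP.n<1+n i) i<G)) (bin-+-frob-< n (suc i) i<G) ⟩
      bin n i + bin n (suc i)
        ≈⟨ sym (bin-pascal n i) ⟩
      bin (suc n) (suc i) ∎

  module _ {G′ : ℕ} (frob : FrobeniusExponent (suc G′)) where
    private
      G = suc G′

    bin-+-frob : ∀ n i → bin (n ℕ.+ G) (G ℕ.+ i) ≈ bin n (G ℕ.+ i) + bin n i
    bin-+-frob zero    zero    = begin
      bin G (G ℕ.+ 0)  ≡⟨ P.cong (bin G) (ℕP.+-identityʳ G) ⟩
      bin G G          ≈⟨ bin-diag G ⟩
      1#               ≈⟨ sym (+-identityˡ 1#) ⟩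
      0# + 1#          ≈⟨ +-congˡ (sym (bin-0 0)) ⟩
      0# + bin 0 0     ∎
    bin-+-frob zero    (suc i) = trans (bin-> G (G ℕ.+ suc i) (ℕP.m<m+n G (s≤s z≤n))) (sym (+-identityˡ 0#))
    bin-+-frob (suc n) i = begin
      bin (suc n ℕ.+ G) (G ℕ.+ i)                              ≈⟨ bin-pascal (n ℕ.+ G) (G′ ℕ.+ i) ⟩
      bin (n ℕ.+ G) (G′ ℕ.+ i) + bin (n ℕ.+ G) (G ℕ.+ i)        ≈⟨ +-congˡ (bin-+-frob n i) ⟩
      bin (n ℕ.+ G) (G′ ℕ.+ i) + (bin n (G ℕ.+ i) + bin n i)    ≈⟨ step i ⟩
      (bin n (G′ ℕ.+ i) + bin n (G ℕ.+ i)) + bin (suc n) i      ≈⟨ +-congʳ (sym (bin-pascal n (G′ ℕ.+ i))) ⟩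
      bin (suc n) (G ℕ.+ i) + bin (suc n) i                    ∎
      where
      step : ∀ i → bin (n ℕ.+ G) (G′ ℕ.+ i) + (bin n (G ℕ.+ i) + bin n i)
                 ≈ (bin n (G′ ℕ.+ i) + bin n (G ℕ.+ i)) + bin (suc n) i
      step zero = begin
        bin (n ℕ.+ G) (G′ ℕ.+ 0) + (bin n (G ℕ.+ 0) + bin n 0)
          ≈⟨ +-congʳ (bin-+-frob-< frob n (G′ ℕ.+ 0) (s≤s (ℕP.≤-reflexive (ℕP.+-identityʳ G′)))) ⟩
        bin n (G′ ℕ.+ 0) + (bin n (G ℕ.+ 0) + bin n 0)
          ≈⟨ sym (+-assoc _ _ _) ⟩
        (bin n (G′ ℕ.+ 0) + bin n (G ℕ.+ 0)) + bin (suc n) 0 ∎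
      step (suc i) = begin
        bin (n ℕ.+ G) (G′ ℕ.+ suc i) + (bin n (G ℕ.+ suc i) + bin n (suc i))
          ≡⟨ P.cong (λ k → bin (n ℕ.+ G) k + (bin n (G ℕ.+ suc i) + bin n (suc i))) (ℕP.+-suc G′ i) ⟩
        bin (n ℕ.+ G) (G ℕ.+ i) + (bin n (G ℕ.+ suc i) + bin n (suc i))
          ≈⟨ +-congʳ (bin-+-frob n i) ⟩
        (bin n (G ℕ.+ i) + bin n i) + (bin n (G ℕ.+ suc i) + bin n (suc i))
          ≈⟨ +-interchange _ _ _ _ ⟩
        (bin n (G ℕ.+ i) + bin n (G ℕ.+ suc i)) + (bin n i + bin n (suc i))
          ≡⟨ P.cong (λ k → (bin n k + bin n (G ℕ.+ suc i)) + (bin n i + bin n (suc i))) (P.sym (ℕP.+-suc G′ i)) ⟩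
        (bin n (G′ ℕ.+ suc i) + bin n (G ℕ.+ suc i)) + (bin n i + bin n (suc i))
          ≈⟨ +-congˡ (sym (bin-pascal n i)) ⟩
        (bin n (G′ ℕ.+ suc i) + bin n (G ℕ.+ suc i)) + bin (suc n) (suc i) ∎

    bin-pred-frob : ∀ i → i ℕ.≤ G′ → bin G′ i ≈ (- 1#) ^ i
    bin-pred-frob zero    _    = bin-0 G′
    bin-pred-frob (suc i) i<G′ = begin
      bin G′ (suc i)
        ≈⟨ sym (//-rightDividesʳ (bin G′ i) _) ⟩
      (bin G′ (suc i) + bin G′ i) - bin G′ i
        ≈⟨ +-cong (trans (+-comm _ _) (sym (bin-pascal G′ i))) (-‿cong (bin-pred-frob i (ℕP.<⇒≤ i<G′))) ⟩
      bin G (suc i) - (- 1#) ^ i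
        ≈⟨ +-congʳ (frob (suc i) (s≤s z≤n) (s≤s i<G′)) ⟩
      0# - (- 1#) ^ i
        ≈⟨ +-identityˡ _ ⟩
      - ((- 1#) ^ i)
        ≈⟨ sym (-1*x≈-x _) ⟩
      (- 1#) ^ suc i ∎

    -1^-frob : (- 1#) ^ G ≈ - 1#
    -1^-frob = begin
      - 1# * (- 1#) ^ G′    ≈⟨ -1*x≈-x _ ⟩
      - ((- 1#) ^ G′)       ≈⟨ -‿cong (sym (bin-pred-frob G′ ℕP.≤-refl)) ⟩
      - bin G′ G′           ≈⟨ -‿cong (bin-diag G′) ⟩
      - 1#                  ∎

  -- With q = pQ this is Lucas' theorem for x = q - 1 - Q, whose base-p digits
  -- below the top one are all p - 1.
  module _ {Q′ q′ x : ℕ} (frobQ : FrobeniusExponent (suc Q′)) (frobq : FrobeniusExponent (suc q′))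
           (x+Q≡q′ : x ℕ.+ suc Q′ ≡ q′) where
    private
      Q = suc Q′

    bin-frob-digits : ∀ u r → r ℕ.< Q → u ℕ.* Q ℕ.+ r ℕ.≤ x →
                      bin x (u ℕ.* Q ℕ.+ r) ≈ (- 1#) ^ (u ℕ.* Q ℕ.+ r) * natF (suc u)
    bin-frob-digits zero    r r<Q r≤x = begin
      bin x r              ≈⟨ sym (bin-+-frob-< frobQ x r r<Q) ⟩
      bin (x ℕ.+ Q) r      ≡⟨ P.cong (λ n → bin n r) x+Q≡q′ ⟩
      bin q′ r             ≈⟨ bin-pred-frob frobq r (P.subst (r ℕ.≤_) x+Q≡q′ (ℕP.m≤n⇒m≤n+o Q r≤x)) ⟩
      (- 1#) ^ r           ≈⟨ sym (*-identityʳ _) ⟩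
      (- 1#) ^ r * 1#      ≈⟨ *-congˡ (sym (+-identityʳ 1#)) ⟩
      (- 1#) ^ r * natF 1  ∎
    bin-frob-digits (suc u) r r<Q k≤x = begin
      bin x k                                    ≡⟨ P.cong (bin x) k≡Q+I ⟩
      bin x (Q ℕ.+ I)                            ≈⟨ sym (//-rightDividesʳ (bin x I) _) ⟩
      (bin x (Q ℕ.+ I) + bin x I) - bin x I      ≈⟨ +-cong (sym (bin-+-frob frobQ x I)) (-‿cong IH) ⟩
      bin (x ℕ.+ Q) (Q ℕ.+ I) - s * n            ≡⟨ P.cong (λ m → bin m (Q ℕ.+ I) - s * n) x+Q≡q′ ⟩
      bin q′ (Q ℕ.+ I) - s * n                   ≈⟨ +-congʳ (bin-pred-frob frobq (Q ℕ.+ I) Q+I≤q′) ⟩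
      (- 1#) ^ (Q ℕ.+ I) - s * n                 ≈⟨ +-congʳ sign ⟩
      - s - s * n                                ≈⟨ +-cong (sym (*-identityʳ _)) (-‿distribˡ-* s n) ⟩
      - s * 1# + - s * n                         ≈⟨ sym (distribˡ (- s) 1# n) ⟩
      - s * natF (suc (suc u))                   ≈⟨ *-congʳ (sym sign) ⟩
      (- 1#) ^ (Q ℕ.+ I) * natF (suc (suc u))    ≡⟨ P.cong (λ m → (- 1#) ^ m * natF (suc (suc u))) (P.sym k≡Q+I) ⟩
      (- 1#) ^ k * natF (suc (suc u))            ∎
      where
      I = u ℕ.* Q ℕ.+ r
      k = suc u ℕ.* Q ℕ.+ r
      s = (- 1#) ^ I
      n = natF (suc u)
      k≡Q+I : k ≡ Q ℕ.+ I
      k≡Q+I = ℕP.+-assoc Q (u ℕ.* Q) r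
      Q+I≤x : Q ℕ.+ I ℕ.≤ x
      Q+I≤x = P.subst (ℕ._≤ x) k≡Q+I k≤x
      Q+I≤q′ : Q ℕ.+ I ℕ.≤ q′
      Q+I≤q′ = P.subst (Q ℕ.+ I ℕ.≤_) x+Q≡q′ (ℕP.m≤n⇒m≤n+o Q Q+I≤x)
      IH : bin x I ≈ s * n
      IH = bin-frob-digits u r r<Q (ℕP.≤-trans (ℕP.m≤n+m I Q) Q+I≤x)
      sign : (- 1#) ^ (Q ℕ.+ I) ≈ - s
      sign = begin
        (- 1#) ^ (Q ℕ.+ I)       ≈⟨ ^-+ (- 1#) Q I ⟩
        (- 1#) ^ Q * s           ≈⟨ *-congʳ (-1^-frob frobQ) ⟩
        - 1# * s                 ≈⟨ -1*x≈-x s ⟩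
        - s                      ∎

module UnivariatePolynomials {c ℓ : Level} (R : CommutativeRing c ℓ) where
  open RingArithmetic R
  open IntegerSolver
  open FiniteSums R
  open Binomials R
  open import Data.List.Membership.Setoid setoid using (_∈_)
  open import Data.List.Relation.Unary.Any using (here; there)

  horner : List F → F → F
  horner []       x = 0#
  horner (a ∷ as) x = a + x * horner as x

  -- For p = c ∷ P, the quotient of p(X) - p(a) by X - a; it does not depend on c.
  syntheticQuotient : F → List F → List F
  syntheticQuotient a []      = []
  syntheticQuotient a (d ∷ P) = horner (d ∷ P) a ∷ syntheticQuotient a P

  length-syntheticQuotient : ∀ a P → List.length (syntheticQuotient a P) ≡ List.length P
  length-syntheticQuotient a []      = P.refl
  length-syntheticQuotient a (d ∷ P) = P.cong suc (length-syntheticQuotient a P)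

  horner-factor : ∀ x a c P → horner (c ∷ P) x - horner (c ∷ P) a ≈ (x - a) * horner (syntheticQuotient a P) x
  horner-factor x a c [] = trans (x≈y⇒x∙y⁻¹≈ε (+-congˡ (trans (zeroʳ x) (sym (zeroʳ a))))) (sym (zeroʳ (x - a)))
  horner-factor x a c (d ∷ P) = begin
    (c + x * (d + x * px)) - (c + a * (d + a * pa))
      ≈⟨ solve 6 (λ x a c d px pa → (c :+ x :* (d :+ x :* px)) :- (c :+ a :* (d :+ a :* pa))
                   := (x :- a) :* (d :+ a :* pa) :+ x :* ((d :+ x :* px) :- (d :+ a :* pa))) refl x a c d px pa ⟩
    (x - a) * (d + a * pa) + x * ((d + x * px) - (d + a * pa))
      ≈⟨ +-congˡ (*-congˡ (horner-factor x a d P)) ⟩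
    (x - a) * (d + a * pa) + x * ((x - a) * qx)
      ≈⟨ solve 4 (λ x a u q → (x :- a) :* u :+ x :* ((x :- a) :* q) := (x :- a) :* (u :+ x :* q)) refl x a (d + a * pa) qx ⟩
    (x - a) * ((d + a * pa) + x * qx) ∎
    where
    px = horner P x
    pa = horner P a
    qx = horner (syntheticQuotient a P) x

  evalPoly : ℕ → (ℕ → F) → F → F
  evalPoly N c x = ∑[ i < N ] (c i * x ^ i)

  horner-applyUpTo : ∀ N c x → horner (List.applyUpTo c N) x ≈ evalPoly N c x
  horner-applyUpTo zero    c x = refl
  horner-applyUpTo (suc N) c x = begin
    c 0 + x * horner (List.applyUpTo (λ i → c (suc i)) N) x
      ≈⟨ +-cong (sym (*-identityʳ _)) (*-congˡ (horner-applyUpTo N _ x)) ⟩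
    c 0 * 1# + x * ∑[ i < N ] (c (suc i) * x ^ i)
      ≈⟨ +-congˡ (sumBelow-*ˡ N x _) ⟩
    c 0 * 1# + ∑[ i < N ] (x * (c (suc i) * x ^ i))
      ≈⟨ +-congˡ (sumBelow-cong N (λ i _ → x*[y*z]≈y*[x*z] x (c (suc i)) (x ^ i))) ⟩
    c 0 * 1# + ∑[ i < N ] (c (suc i) * x ^ suc i) ∎

  shiftPoly : ℕ → (ℕ → F) → F → ℕ → F
  shiftPoly N c b j = ∑[ i < N ] (c i * (bin i j * b ^ (i ∸ j)))

  evalPoly-shift : ∀ N c b x → evalPoly N (shiftPoly N c b) x ≈ evalPoly N c (x + b)
  evalPoly-shift N c b x = begin
    ∑[ j < N ] (∑[ i < N ] (c i * (bin i j * b ^ (i ∸ j))) * x ^ j)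
      ≈⟨ sumBelow-cong N (λ j _ → trans (sumBelow-*ʳ N (x ^ j) _) (sumBelow-cong N (λ i _ → rearrange i j))) ⟩
    ∑[ j < N ] ∑[ i < N ] (c i * (bin i j * (x ^ j * b ^ (i ∸ j))))
      ≈⟨ sumBelow-swap N N _ ⟩
    ∑[ i < N ] ∑[ j < N ] (c i * (bin i j * (x ^ j * b ^ (i ∸ j))))
      ≈⟨ sumBelow-cong N (λ i i<N → trans (sym (sumBelow-*ˡ N (c i) _)) (*-congˡ (expand i i<N))) ⟩
    ∑[ i < N ] (c i * (x + b) ^ i) ∎
    where
    rearrange : ∀ i j → (c i * (bin i j * b ^ (i ∸ j))) * x ^ j ≈ c i * (bin i j * (x ^ j * b ^ (i ∸ j)))
    rearrange i j = solve 4 (λ u v w y → (u :* (v :* w)) :* y := u :* (v :* (y :* w))) refl (c i) (bin i j) (b ^ (i ∸ j)) (x ^ j)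
    expand : ∀ i → i ℕ.< N → ∑[ j < N ] (bin i j * (x ^ j * b ^ (i ∸ j))) ≈ (x + b) ^ i
    expand i i<N = trans (sumBelow-extend (suc i) N _ i<N (λ j i<j → x≈0⇒xy≈0 (bin-> i j i<j)))
                         (sym (binomial-theorem x b i))

  evalPoly-- : ∀ N c d x → evalPoly N (λ i → c i - d i) x ≈ evalPoly N c x - evalPoly N d x
  evalPoly-- N c d x = trans (sumBelow-cong N (λ i _ → [y-z]x≈yx-zx (x ^ i) (c i) (d i)))
                             (sumBelow-- N (λ i → c i * x ^ i) (λ i → d i * x ^ i))

  constPoly : F → ℕ → F
  constPoly a zero    = a
  constPoly a (suc i) = 0#

  evalPoly-const : ∀ N a x → evalPoly (suc N) (constPoly a) x ≈ a
  evalPoly-const N a x = trans (+-cong (*-identityʳ a) (sumBelow-zero N (λ i _ → zeroˡ (x ^ suc i)))) (+-identityʳ a)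

  shiftPoly-reindex : ∀ j M c b → shiftPoly (j ℕ.+ M) c b j ≈ evalPoly M (λ r → c (j ℕ.+ r) * bin (j ℕ.+ r) j) b
  shiftPoly-reindex j M c b = begin
    shiftPoly (j ℕ.+ M) c b j
      ≈⟨ sumBelow-split j M _ ⟩
    ∑[ i < j ] term i + ∑[ r < M ] term (j ℕ.+ r)
      ≈⟨ +-congʳ (sumBelow-zero j (λ i i<j → y≈0⇒xy≈0 (x≈0⇒xy≈0 (bin-> i j i<j)))) ⟩
    0# + ∑[ r < M ] term (j ℕ.+ r)
      ≈⟨ +-identityˡ _ ⟩
    ∑[ r < M ] term (j ℕ.+ r)
      ≈⟨ sumBelow-cong M (λ r _ → reassociate r) ⟩
    evalPoly M (λ r → c (j ℕ.+ r) * bin (j ℕ.+ r) j) b ∎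
    where
    term : ℕ → F
    term i = c i * (bin i j * b ^ (i ∸ j))
    reassociate : ∀ r → term (j ℕ.+ r) ≈ (c (j ℕ.+ r) * bin (j ℕ.+ r) j) * b ^ r
    reassociate r = begin
      c (j ℕ.+ r) * (bin (j ℕ.+ r) j * b ^ ((j ℕ.+ r) ∸ j))
        ≡⟨ P.cong (λ k → c (j ℕ.+ r) * (bin (j ℕ.+ r) j * b ^ k)) (ℕP.m+n∸m≡n j r) ⟩
      c (j ℕ.+ r) * (bin (j ℕ.+ r) j * b ^ r)
        ≈⟨ sym (*-assoc _ _ _) ⟩
      (c (j ℕ.+ r) * bin (j ℕ.+ r) j) * b ^ r ∎

  timesX : (ℕ → F) → ℕ → F
  timesX c zero    = 0#
  timesX c (suc i) = c i

  timesRoot : F → (ℕ → F) → ℕ → F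
  timesRoot a c i = timesX c i - a * c i

  evalPoly-timesRoot : ∀ N a c x → evalPoly (suc N) (timesRoot a c) x ≈ x * evalPoly N c x - a * evalPoly (suc N) c x
  evalPoly-timesRoot N a c x = begin
    ∑[ i < suc N ] ((timesX c i - a * c i) * x ^ i)
      ≈⟨ sumBelow-cong (suc N) (λ i _ → solve 4 (λ t a u y → (t :- a :* u) :* y := t :* y :- a :* (u :* y)) refl (timesX c i) a (c i) (x ^ i)) ⟩
    ∑[ i < suc N ] (timesX c i * x ^ i - a * (c i * x ^ i))
      ≈⟨ sumBelow-- (suc N) (λ i → timesX c i * x ^ i) (λ i → a * (c i * x ^ i)) ⟩
    evalPoly (suc N) (timesX c) x - ∑[ i < suc N ] (a * (c i * x ^ i))
      ≈⟨ +-cong shifted (-‿cong (sym (sumBelow-*ˡ (suc N) a (λ i → c i * x ^ i)))) ⟩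
    x * evalPoly N c x - a * evalPoly (suc N) c x ∎
    where
    shifted : evalPoly (suc N) (timesX c) x ≈ x * evalPoly N c x
    shifted = begin
      0# * 1# + ∑[ i < N ] (c i * (x * x ^ i))  ≈⟨ +-cong (zeroˡ 1#) (sumBelow-cong N (λ i _ → x*[y*z]≈y*[x*z] (c i) x (x ^ i))) ⟩
      0# + ∑[ i < N ] (x * (c i * x ^ i))       ≈⟨ +-identityˡ _ ⟩
      ∑[ i < N ] (x * (c i * x ^ i))            ≈⟨ sym (sumBelow-*ˡ N x _) ⟩
      x * evalPoly N c x                        ∎

  -- Coefficients of the monic polynomial ∏_{a ∈ L} (X - a).
  annihilator : List F → ℕ → F
  annihilator []      zero    = 1#
  annihilator []      (suc i) = 0#
  annihilator (a ∷ L)         = timesRoot a (annihilator L)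

  annihilator-> : ∀ L i → List.length L ℕ.< i → annihilator L i ≈ 0#
  annihilator-> []      (suc i) _           = refl
  annihilator-> (a ∷ L) (suc i) (s≤s |L|<i) = begin
    annihilator L i - a * annihilator L (suc i)
      ≈⟨ +-cong (annihilator-> L i |L|<i) (-‿cong (y≈0⇒xy≈0 (annihilator-> L (suc i) (ℕP.m<n⇒m<1+n |L|<i)))) ⟩
    0# - 0#
      ≈⟨ x-0≈x 0# ⟩
    0# ∎

  annihilator-monic : ∀ L → annihilator L (List.length L) ≈ 1#
  annihilator-monic []      = refl
  annihilator-monic (a ∷ L) = begin
    annihilator L (List.length L) - a * annihilator L (suc (List.length L))
      ≈⟨ +-cong (annihilator-monic L) (-‿cong (y≈0⇒xy≈0 (annihilator-> L _ (ℕP.n<1+n _)))) ⟩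
    1# - 0#
      ≈⟨ x-0≈x 1# ⟩
    1# ∎

  evalPoly-annihilator : ∀ L x → evalPoly (suc (List.length L)) (annihilator L) x ≈ ∏[ a ← L ] (x - a)
  evalPoly-annihilator []      x = trans (+-identityʳ _) (*-identityʳ _)
  evalPoly-annihilator (a ∷ L) x = begin
    evalPoly (suc (suc n)) (timesRoot a l) x                     ≈⟨ evalPoly-timesRoot (suc n) a l x ⟩
    x * evalPoly (suc n) l x - a * evalPoly (suc (suc n)) l x    ≈⟨ +-congˡ (-‿cong (*-congˡ degree)) ⟩
    x * evalPoly (suc n) l x - a * evalPoly (suc n) l x          ≈⟨ sym ([y-z]x≈yx-zx _ x a) ⟩
    (x - a) * evalPoly (suc n) l x                               ≈⟨ *-congˡ (evalPoly-annihilator L x) ⟩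
    (x - a) * ∏[ b ← L ] (x - b)                                 ∎
    where
    n = List.length L
    l = annihilator L
    degree : evalPoly (suc (suc n)) l x ≈ evalPoly (suc n) l x
    degree = sumBelow-extend (suc n) (suc (suc n)) (λ i → l i * x ^ i) (ℕP.n≤1+n _) (λ i n<i → x≈0⇒xy≈0 (annihilator-> L i n<i))

  annihilator-root : ∀ L x → x ∈ L → evalPoly (suc (List.length L)) (annihilator L) x ≈ 0#
  annihilator-root L x x∈L = trans (evalPoly-annihilator L x) (∏-root L x∈L)
    where
    ∏-root : ∀ L → x ∈ L → ∏[ b ← L ] (x - b) ≈ 0#
    ∏-root (b ∷ L) (here x≈b)  = x≈0⇒xy≈0 (x≈y⇒x∙y⁻¹≈ε x≈b)
    ∏-root (b ∷ L) (there x∈L) = y≈0⇒xy≈0 (∏-root L x∈L)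

module FieldFacts {c ℓ : Level} (R : CommutativeRing c ℓ) (isField : Poly.IsField R) where
  open RingArithmetic R
  open FiniteSums R
  open UnivariatePolynomials R
  open import Data.List.Membership.Setoid setoid using (_∈_)
  open import Data.List.Membership.Setoid.Properties using (All[≉]⇒∉; ∈-resp-≈)
  open import Data.List.Relation.Unary.All using (All; []; _∷_)
  open import Data.List.Relation.Unary.Any using (here; there)
  open import Data.List.Relation.Unary.AllPairs.Core using ([]; _∷_)
  open import Data.List.Relation.Unary.Unique.Setoid setoid using (Unique)

  1≉0 : ¬ (1# ≈ 0#)
  1≉0 = proj₁ isField

  x≉0∧xy≈0⇒y≈0 : ∀ {x y} → ¬ (x ≈ 0#) → x * y ≈ 0# → y ≈ 0#
  x≉0∧xy≈0⇒y≈0 {x} {y} x≉0 xy≈0 with proj₂ isField x x≉0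
  ... | x⁻¹ , xx⁻¹≈1 = begin
    y                ≈⟨ sym (*-identityˡ y) ⟩
    1# * y           ≈⟨ *-congʳ (sym xx⁻¹≈1) ⟩
    (x * x⁻¹) * y    ≈⟨ *-congʳ (*-comm x x⁻¹) ⟩
    (x⁻¹ * x) * y    ≈⟨ *-assoc x⁻¹ x y ⟩
    x⁻¹ * (x * y)    ≈⟨ *-congˡ xy≈0 ⟩
    x⁻¹ * 0#         ≈⟨ zeroʳ x⁻¹ ⟩
    0#               ∎

  x≉0∧y≉0⇒xy≉0 : ∀ {x y} → ¬ (x ≈ 0#) → ¬ (y ≈ 0#) → ¬ (x * y ≈ 0#)
  x≉0∧y≉0⇒xy≉0 x≉0 y≉0 xy≈0 = y≉0 (x≉0∧xy≈0⇒y≈0 x≉0 xy≈0)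

  -1^≉0 : ∀ i → ¬ ((- 1#) ^ i ≈ 0#)
  -1^≉0 zero    = 1≉0
  -1^≉0 (suc i) = x≉0∧y≉0⇒xy≉0 -1≉0 (-1^≉0 i)
    where
    -1≉0 : ¬ (- 1# ≈ 0#)
    -1≉0 -1≈0 = 1≉0 (trans (sym (-‿involutive 1#)) (trans (-‿cong -1≈0) -0#≈0#))

  synthetic-zero : ∀ a c P → All (_≈ 0#) (syntheticQuotient a P) → horner (c ∷ P) a ≈ 0# → All (_≈ 0#) (c ∷ P)
  synthetic-zero a c []      []           pa≈0 = trans (sym (trans (+-congˡ (zeroʳ a)) (+-identityʳ c))) pa≈0 ∷ []
  synthetic-zero a c (d ∷ P) (qa≈0 ∷ q≈0) pa≈0 = c≈0 ∷ synthetic-zero a d P q≈0 qa≈0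
    where
    c≈0 : c ≈ 0#
    c≈0 = begin
      c                                            ≈⟨ sym (//-rightDividesʳ (a * horner (d ∷ P) a) c) ⟩
      (c + a * horner (d ∷ P) a) - a * horner (d ∷ P) a ≈⟨ +-cong pa≈0 (-‿cong (y≈0⇒xy≈0 qa≈0)) ⟩
      0# - 0#                                      ≈⟨ x-0≈x 0# ⟩
      0#                                           ∎

  horner-roots⇒zero : ∀ {L} → Unique L → ∀ P → List.length P ℕ.≤ List.length L →
                      (∀ x → x ∈ L → horner P x ≈ 0#) → All (_≈ 0#) P
  horner-roots⇒zero _                []      _         _      = []
  horner-roots⇒zero {a ∷ L} (a∉L ∷ L!) (c ∷ P) (s≤s |P|≤|L|) roots =
    synthetic-zero a c P (horner-roots⇒zero L! (syntheticQuotient a P) |Q|≤|L| Q-roots) (roots a (here refl))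
    where
    |Q|≤|L| = P.subst (ℕ._≤ List.length L) (P.sym (length-syntheticQuotient a P)) |P|≤|L|
    Q-roots : ∀ x → x ∈ L → horner (syntheticQuotient a P) x ≈ 0#
    Q-roots x x∈L = x≉0∧xy≈0⇒y≈0 x-a≉0 (begin
      (x - a) * horner (syntheticQuotient a P) x    ≈⟨ sym (horner-factor x a c P) ⟩
      horner (c ∷ P) x - horner (c ∷ P) a          ≈⟨ +-cong (roots x (there x∈L)) (-‿cong (roots a (here refl))) ⟩
      0# - 0#                                      ≈⟨ x-0≈x 0# ⟩
      0#                                           ∎)
      where
      x-a≉0 : ¬ (x - a ≈ 0#)
      x-a≉0 x-a≈0 = All[≉]⇒∉ setoid a∉L (∈-resp-≈ setoid (x∙y⁻¹≈ε⇒x≈y x a x-a≈0) x∈L)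

  roots⇒coefficients≈0 : ∀ {L} → Unique L → ∀ N c → N ℕ.≤ List.length L →
                         (∀ x → x ∈ L → evalPoly N c x ≈ 0#) → ∀ i → i ℕ.< N → c i ≈ 0#
  roots⇒coefficients≈0 {L} L! N c N≤|L| roots i i<N =
    AllP.applyUpTo⁻ c N (horner-roots⇒zero L! (List.applyUpTo c N) |P|≤|L| P-roots) i<N
    where
    |P|≤|L| = P.subst (ℕ._≤ List.length L) (P.sym (ListP.length-applyUpTo c N)) N≤|L|
    P-roots : ∀ x → x ∈ L → horner (List.applyUpTo c N) x ≈ 0#
    P-roots x x∈L = trans (horner-applyUpTo N c x) (roots x x∈L)

  roots⇒coefficients≈0′ : ∀ {L} → Unique L → ∀ N c → (∀ i → List.length L ℕ.≤ i → c i ≈ 0#) →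
                          (∀ x → x ∈ L → evalPoly N c x ≈ 0#) → ∀ i → i ℕ.< N → c i ≈ 0#
  roots⇒coefficients≈0′ {L} L! N c high roots i i<N with N ℕ.≤? List.length L | i ℕ.<? List.length L
  ... | yes N≤|L| | _         = roots⇒coefficients≈0 L! N c N≤|L| roots i i<N
  ... | no _      | no i≮|L|  = high i (ℕP.≮⇒≥ i≮|L|)
  ... | no N≰|L|  | yes i<|L| = roots⇒coefficients≈0 L! (List.length L) c ℕP.≤-refl truncated i i<|L|
    where
    truncated : ∀ x → x ∈ L → evalPoly (List.length L) c x ≈ 0#
    truncated x x∈L = trans (sym (sumBelow-extend (List.length L) N _ (ℕP.<⇒≤ (ℕP.≰⇒> N≰|L|))
                                    (λ j |L|≤j → x≈0⇒xy≈0 (high j |L|≤j))))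
                            (roots x x∈L)

-- For b ∈ A, l(X + b) - l(X) has degree < |A| and vanishes on A, so it is zero.
-- Read as a polynomial in b, the coefficient of X^j in l(X + b) has top
-- coefficient C(|A|, j), which therefore vanishes for 0 < j < |A|.
module SubgroupOrder {c ℓ : Level} (R : CommutativeRing c ℓ) (isField : Poly.IsField R)
                     (A : Poly.FiniteAdditiveSubgroup R) where
  open RingArithmetic R
  open FiniteSums R
  open Binomials R
  open FrobeniusExponents R
  open UnivariatePolynomials R
  open FieldFacts R isField
  open import Data.List.Membership.Setoid setoid using (_∈_)

  private
    E = elems A
    q = card A
    l = annihilator E

  annihilator-translation : ∀ b → b ∈ E → ∀ j → j ℕ.< suc q → shiftPoly (suc q) l b j ≈ l j
  annihilator-translation b b∈E j j≤q =
    x∙y⁻¹≈ε⇒x≈y _ _ (roots⇒coefficients≈0′ (unique A) (suc q) difference high roots j j≤q)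
    where
    difference : ℕ → F
    difference j = shiftPoly (suc q) l b j - l j
    roots : ∀ a → a ∈ E → evalPoly (suc q) difference a ≈ 0#
    roots a a∈E = begin
      evalPoly (suc q) difference a
        ≈⟨ evalPoly-- (suc q) (shiftPoly (suc q) l b) l a ⟩
      evalPoly (suc q) (shiftPoly (suc q) l b) a - evalPoly (suc q) l a
        ≈⟨ +-congʳ (evalPoly-shift (suc q) l b a) ⟩
      evalPoly (suc q) l (a + b) - evalPoly (suc q) l a
        ≈⟨ +-cong (annihilator-root E _ (+-closed A a∈E b∈E)) (-‿cong (annihilator-root E a a∈E)) ⟩
      0# - 0#
        ≈⟨ x-0≈x 0# ⟩
      0# ∎
    term : ℕ → ℕ → F
    term j i = l i * (bin i j * b ^ (i ∸ j))
    top : ∀ j → q ℕ.≤ j → shiftPoly (suc q) l b j ≈ term j q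
    top j q≤j = begin
      shiftPoly (suc q) l b j
        ≈⟨ sumBelow-last q (term j) ⟩
      ∑[ i < q ] term j i + term j q
        ≈⟨ +-congʳ (sumBelow-zero q (λ i i<q → y≈0⇒xy≈0 (x≈0⇒xy≈0 (bin-> i j (ℕP.<-≤-trans i<q q≤j))))) ⟩
      0# + term j q
        ≈⟨ +-identityˡ _ ⟩
      term j q ∎
    high : ∀ j → q ℕ.≤ j → difference j ≈ 0#
    high j q≤j with ℕP.m≤n⇒m<n∨m≡n q≤j
    ... | inj₁ q<j = begin
      shiftPoly (suc q) l b j - l j    ≈⟨ +-cong (top j q≤j) (-‿cong (annihilator-> E j q<j)) ⟩
      term j q - 0#                    ≈⟨ x-0≈x _ ⟩
      l q * (bin q j * b ^ (q ∸ j))    ≈⟨ y≈0⇒xy≈0 (x≈0⇒xy≈0 (bin-> q j q<j)) ⟩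
      0#                               ∎
    ... | inj₂ P.refl = begin
      shiftPoly (suc q) l b q - l q         ≈⟨ +-congʳ (top q q≤j) ⟩
      l q * (bin q q * b ^ (q ∸ q)) - l q   ≡⟨ P.cong (λ k → l q * (bin q q * b ^ k) - l q) (ℕP.n∸n≡0 q) ⟩
      l q * (bin q q * 1#) - l q            ≈⟨ +-congʳ (*-congˡ (trans (*-identityʳ _) (bin-diag q))) ⟩
      l q * 1# - l q                        ≈⟨ +-congʳ (*-identityʳ _) ⟩
      l q - l q                             ≈⟨ -‿inverseʳ _ ⟩
      0#                                    ∎

  frobenius-card : FrobeniusExponent q
  frobenius-card j 0<j j<q with ℕP.m≤n⇒∃[o]m+o≡n j<q
  ... | k , j+1+k≡q = begin
    bin q j                                 ≈⟨ sym (*-identityˡ _) ⟩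
    1# * bin q j                            ≈⟨ *-congʳ (sym (annihilator-monic E)) ⟩
    l q * bin q j                           ≡⟨ P.cong (λ i → l i * bin i j) q≡j+M ⟩
    coefficient M                           ≈⟨ sym (x-0≈x _) ⟩
    coefficient M - constPoly (l j) M       ≈⟨ coefficients≈0 M (ℕP.n<1+n M) ⟩
    0#                                      ∎
    where
    M = suc k
    q≡j+M : q ≡ j ℕ.+ M
    q≡j+M = P.trans (P.sym j+1+k≡q) (P.sym (ℕP.+-suc j k))
    coefficient : ℕ → F
    coefficient r = l (j ℕ.+ r) * bin (j ℕ.+ r) j
    roots : ∀ b → b ∈ E → evalPoly (suc M) (λ r → coefficient r - constPoly (l j) r) b ≈ 0#
    roots b b∈E = begin
      evalPoly (suc M) (λ r → coefficient r - constPoly (l j) r) b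
        ≈⟨ evalPoly-- (suc M) coefficient (constPoly (l j)) b ⟩
      evalPoly (suc M) coefficient b - evalPoly (suc M) (constPoly (l j)) b
        ≈⟨ +-cong (sym (shiftPoly-reindex j (suc M) l b)) (-‿cong (evalPoly-const M (l j) b)) ⟩
      shiftPoly (j ℕ.+ suc M) l b j - l j
        ≡⟨ P.cong (λ N → shiftPoly N l b j - l j) (P.trans (ℕP.+-suc j M) (P.cong suc (P.sym q≡j+M))) ⟩
      shiftPoly (suc q) l b j - l j
        ≈⟨ +-congʳ (annihilator-translation b b∈E j (ℕP.<-trans j<q (ℕP.n<1+n q))) ⟩
      l j - l j
        ≈⟨ -‿inverseʳ _ ⟩
      0# ∎
    M+1≤q : suc M ℕ.≤ q
    M+1≤q = P.subst (suc M ℕ.≤_) (P.sym q≡j+M) (ℕP.+-monoˡ-≤ M 0<j)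
    coefficients≈0 : ∀ r → r ℕ.< suc M → coefficient r - constPoly (l j) r ≈ 0#
    coefficients≈0 = roots⇒coefficients≈0 (unique A) (suc M) (λ r → coefficient r - constPoly (l j) r) M+1≤q roots

module PrimeCharacteristic {c ℓ : Level} (R : CommutativeRing c ℓ) (isField : Poly.IsField R)
                           (p′ : ℕ) (char : Poly.HasCharacteristic R (suc p′)) where
  open RingArithmetic R
  open Binomials R
  open FrobeniusExponents R
  open FieldFacts R isField

  private
    p = suc p′

  natF-p : natF p ≈ 0#
  natF-p = proj₁ char

  natF≉0 : ∀ k → 0 ℕ.< k → k ℕ.< p → ¬ (natF k ≈ 0#)
  natF≉0 = proj₂ char

  1<p : 1 ℕ.< p
  1<p = nontrivial p′ natF-p
    where
    nontrivial : ∀ n → natF (suc n) ≈ 0# → 1 ℕ.< suc n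
    nontrivial zero    natF-1≈0 = ⊥-elim (1≉0 (trans (sym (+-identityʳ 1#)) natF-1≈0))
    nontrivial (suc n) _        = s≤s (s≤s z≤n)

  natF-% : ∀ n → natF n ≈ natF (n % p)
  natF-% n = begin
    natF n                                ≡⟨ P.cong natF (m≡m%n+[m/n]*n n p) ⟩
    natF (n % p ℕ.+ n / p ℕ.* p)          ≈⟨ natF-+ (n % p) _ ⟩
    natF (n % p) + natF (n / p ℕ.* p)     ≈⟨ +-congˡ (trans (natF-* (n / p) p) (y≈0⇒xy≈0 natF-p)) ⟩
    natF (n % p) + 0#                     ≈⟨ +-identityʳ _ ⟩
    natF (n % p)                          ∎

  natF≈0⇒p∣ : ∀ n → natF n ≈ 0# → p ∣ n
  natF≈0⇒p∣ n natF-n≈0 with n % p in n%p≡r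
  ... | zero  = m%n≡0⇒n∣m n p n%p≡r
  ... | suc r = ⊥-elim (natF≉0 (suc r) (s≤s z≤n) (P.subst (ℕ._< p) n%p≡r (m%n<n n p))
                          (trans (sym (trans (natF-% n) (reflexive (P.cong natF n%p≡r)))) natF-n≈0))

  frobenius-p : FrobeniusExponent p
  frobenius-p (suc t) 0<t t<p = x≉0∧xy≈0⇒y≈0 (natF≉0 (suc t) 0<t t<p) (begin
    natF (suc t) * bin p (suc t)      ≈⟨ sym (natF-* (suc t) (p C suc t)) ⟩
    natF (suc t ℕ.* (p C suc t))      ≡⟨ P.cong natF ([1+k]*[1+n]C[1+k]≡[1+n]*nCk p′ t) ⟩
    natF (p ℕ.* (p′ C t))             ≈⟨ natF-* p (p′ C t) ⟩
    natF p * bin p′ t                 ≈⟨ *-congʳ natF-p ⟩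
    0# * bin p′ t                     ≈⟨ zeroˡ _ ⟩
    0#                                ∎)

  bin-*p : ∀ u v → bin (u ℕ.* p) (v ℕ.* p) ≈ bin u v
  bin-*p zero    zero    = refl
  bin-*p zero    (suc v) = refl
  bin-*p (suc u) zero    = refl
  bin-*p (suc u) (suc v) = begin
    bin (p ℕ.+ u ℕ.* p) (p ℕ.+ v ℕ.* p)                    ≡⟨ P.cong (λ n → bin n (p ℕ.+ v ℕ.* p)) (ℕP.+-comm p (u ℕ.* p)) ⟩
    bin (u ℕ.* p ℕ.+ p) (p ℕ.+ v ℕ.* p)                    ≈⟨ bin-+-frob frobenius-p (u ℕ.* p) (v ℕ.* p) ⟩
    bin (u ℕ.* p) (suc v ℕ.* p) + bin (u ℕ.* p) (v ℕ.* p)  ≈⟨ +-cong (bin-*p u (suc v)) (bin-*p u v) ⟩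
    bin u (suc v) + bin u v                                ≈⟨ +-comm _ _ ⟩
    bin u v + bin u (suc v)                                ≈⟨ sym (bin-pascal u v) ⟩
    bin (suc u) (suc v)                                    ∎

  frobenius-/p : ∀ Q → FrobeniusExponent (Q ℕ.* p) → FrobeniusExponent Q
  frobenius-/p Q frob t 0<t t<Q = trans (sym (bin-*p Q t)) (frob (t ℕ.* p) (ℕP.*-monoˡ-< p 0<t) (ℕP.*-monoˡ-< p t<Q))

  p∣frobenius : ∀ q → 1 ℕ.< q → FrobeniusExponent q → p ∣ q
  p∣frobenius q 1<q frob = natF≈0⇒p∣ q (trans (reflexive (P.cong natF (P.sym (nC1≡n q)))) (frob 1 (s≤s z≤n) 1<q))

  module _ {Q′ q′ x : ℕ} (frobQ : FrobeniusExponent (suc Q′)) (frobq : FrobeniusExponent (suc q′))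
           (x+Q≡q′ : x ℕ.+ suc Q′ ≡ q′) (q≡Qp : suc q′ ≡ suc Q′ ℕ.* p) where
    private
      Q = suc Q′

    bin-digits≉0 : ∀ i → i ℕ.≤ x → ¬ (bin x i ≈ 0#)
    bin-digits≉0 i i≤x bin≈0 = x≉0∧y≉0⇒xy≉0 (-1^≉0 (u ℕ.* Q ℕ.+ r)) (natF≉0 (suc u) (s≤s z≤n) 1+u<p)
      (trans (sym (bin-frob-digits frobQ frobq x+Q≡q′ u r (m%n<n i Q) (P.subst (ℕ._≤ x) i≡uQ+r i≤x)))
             (trans (reflexive (P.cong (bin x) (P.sym i≡uQ+r))) bin≈0))
      where
      u = i / Q
      r = i % Q
      i≡uQ+r : i ≡ u ℕ.* Q ℕ.+ r
      i≡uQ+r = P.trans (m≡m%n+[m/n]*n i Q) (ℕP.+-comm r (u ℕ.* Q))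
      1+u<p : suc u ℕ.< p
      1+u<p = ℕP.*-cancelʳ-< Q (suc u) p (digit-bound {u = u} {r = r} x+Q≡q′ q≡Qp (P.subst (ℕ._≤ x) i≡uQ+r i≤x))

module PowerSums {c ℓ : Level} (R : CommutativeRing c ℓ) (isField : Poly.IsField R)
                 (A : Poly.FiniteAdditiveSubgroup R) where
  open RingArithmetic R
  open IntegerSolver
  open FiniteSums R
  open Binomials R
  open FrobeniusExponents R
  open UnivariatePolynomials R
  open FieldFacts R isField
  open import Data.List.Membership.Setoid setoid using (_∈_)
  open import Data.List.Membership.Setoid.Properties using (∈-resp-≈; ∈-map⁻; ∈-length)
  import Data.List.Relation.Unary.Unique.Setoid.Properties as Unique

  private
    E = elems A
    q = card A

  powerSum : ℕ → F
  powerSum k = ∑[ a ← E ] (a ^ k)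

  powerSum-translation : ∀ b → b ∈ E → ∀ k → ∑[ a ← E ] ((a + b) ^ k) ≈ powerSum k
  powerSum-translation b b∈E k = begin
    ∑[ a ← E ] ((a + b) ^ k)                 ≈⟨ sym (sumList-map E (_+ b) (_^ k)) ⟩
    sumList (List.map (_+ b) E) (_^ k)     ≈⟨ sumList-⊆ (^-cong k) E+b! E+b⊆E (ListP.length-map (_+ b) E) ⟩
    powerSum k                             ∎
    where
    E+b! = Unique.map⁺ setoid setoid (λ {x} {y} → +-cancelʳ b x y) (unique A)
    E+b⊆E : ∀ {y} → y ∈ List.map (_+ b) E → y ∈ E
    E+b⊆E y∈E+b with ∈-map⁻ setoid setoid y∈E+b
    ... | a , a∈E , y≈a+b = ∈-resp-≈ setoid (sym y≈a+b) (+-closed A a∈E (b∈E))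

  powerSum-expansion : ∀ b → b ∈ E → ∀ k → evalPoly (suc k) (λ i → bin k i * powerSum (k ∸ i)) b ≈ powerSum k
  powerSum-expansion b b∈E k = begin
    ∑[ i < suc k ] ((bin k i * powerSum (k ∸ i)) * b ^ i)
      ≈⟨ sumBelow-cong (suc k) (λ i _ → trans (*-congʳ (sumList-*ˡ E (bin k i) (_^ (k ∸ i))))
                                              (sumList-*ʳ E (b ^ i) (λ a → bin k i * a ^ (k ∸ i)))) ⟩
    ∑[ i < suc k ] ∑[ a ← E ] ((bin k i * a ^ (k ∸ i)) * b ^ i)
      ≈⟨ sym (sumList-sumBelow E (suc k) (λ a i → (bin k i * a ^ (k ∸ i)) * b ^ i)) ⟩
    ∑[ a ← E ] ∑[ i < suc k ] ((bin k i * a ^ (k ∸ i)) * b ^ i)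
      ≈⟨ sumList-cong E (λ a → trans (sumBelow-cong (suc k) (λ i _ → rearrange a i)) (sym (binomial-theorem b a k))) ⟩
    ∑[ a ← E ] ((b + a) ^ k)
      ≈⟨ sumList-cong E (λ a → ^-cong k (+-comm b a)) ⟩
    ∑[ a ← E ] ((a + b) ^ k)
      ≈⟨ powerSum-translation b b∈E k ⟩
    powerSum k ∎
    where
    rearrange : ∀ a i → (bin k i * a ^ (k ∸ i)) * b ^ i ≈ bin k i * (b ^ i * a ^ (k ∸ i))
    rearrange a i = solve 3 (λ u v w → (u :* v) :* w := u :* (w :* v)) refl (bin k i) (a ^ (k ∸ i)) (b ^ i)

  1≤q : 1 ℕ.≤ q
  1≤q = ∈-length setoid (has-zero A)

  -- Translation by b ∈ A fixes S(k), so ∑ᵢ C(k,i) S(k-i) bⁱ - S(k) is a polynomial in b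
  -- vanishing on A; its coefficients below |A| therefore vanish.
  powerSum-relation : ∀ k → (∀ i → q ℕ.≤ i → i ℕ.≤ k → powerSum (k ∸ i) ≈ 0#) →
                      ∀ i → 0 ℕ.< i → i ℕ.≤ k → bin k i * powerSum (k ∸ i) ≈ 0#
  powerSum-relation k vanish (suc i) _ i<k =
    trans (sym (x-0≈x _)) (roots⇒coefficients≈0′ (unique A) (suc k) d high roots (suc i) (s≤s i<k))
    where
    coefficient : ℕ → F
    coefficient i = bin k i * powerSum (k ∸ i)
    d : ℕ → F
    d i = coefficient i - constPoly (powerSum k) i
    roots : ∀ b → b ∈ E → evalPoly (suc k) d b ≈ 0#
    roots b b∈E = begin
      evalPoly (suc k) d b
        ≈⟨ evalPoly-- (suc k) coefficient (constPoly (powerSum k)) b ⟩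
      evalPoly (suc k) coefficient b - evalPoly (suc k) (constPoly (powerSum k)) b
        ≈⟨ +-cong (powerSum-expansion b b∈E k) (-‿cong (evalPoly-const k (powerSum k) b)) ⟩
      powerSum k - powerSum k
        ≈⟨ -‿inverseʳ _ ⟩
      0# ∎
    high : ∀ i → q ℕ.≤ i → d i ≈ 0#
    high zero    q≤0 = ⊥-elim (ℕP.<⇒≱ 1≤q q≤0)
    high (suc i) q≤i with suc i ℕ.≤? k
    ... | yes i<k = trans (x-0≈x _) (y≈0⇒xy≈0 (vanish (suc i) q≤i i<k))
    ... | no  i≮k = trans (x-0≈x _) (x≈0⇒xy≈0 (bin-> k (suc i) (ℕP.≰⇒> i≮k)))

  powerSum≈0 : ∀ k i → (∀ i → q ℕ.≤ i → i ℕ.≤ k → powerSum (k ∸ i) ≈ 0#) →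
               0 ℕ.< i → i ℕ.≤ k → ¬ (bin k i ≈ 0#) → powerSum (k ∸ i) ≈ 0#
  powerSum≈0 k i vanish 0<i i≤k bin≉0 = x≉0∧xy≈0⇒y≈0 bin≉0 (powerSum-relation k vanish i 0<i i≤k)

  powerSum-low : ∀ j → j ℕ.< q ∸ 1 → powerSum j ≈ 0#
  powerSum-low j j<q′ = P.subst (λ m → powerSum m ≈ 0#) (ℕP.m∸[m∸n]≡n (ℕP.<⇒≤ j<q′))
    (powerSum≈0 q′ i vacuous (ℕP.m<n⇒0<n∸m j<q′) i≤q′ bin≉0)
    where
    q′ = q ∸ 1
    1+q′≡q : suc q′ ≡ q
    1+q′≡q = P.trans (ℕP.+-comm 1 q′) (ℕP.m∸n+n≡m 1≤q)
    q′<q : q′ ℕ.< q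
    q′<q = P.subst (q′ ℕ.<_) 1+q′≡q (ℕP.n<1+n q′)
    frob : FrobeniusExponent (suc q′)
    frob = P.subst FrobeniusExponent (P.sym 1+q′≡q) (SubgroupOrder.frobenius-card R isField A)
    i = q′ ∸ j
    i≤q′ : i ℕ.≤ q′
    i≤q′ = ℕP.m∸n≤m q′ j
    vacuous : ∀ i → q ℕ.≤ i → i ℕ.≤ q′ → powerSum (q′ ∸ i) ≈ 0#
    vacuous i q≤i i≤q′ = ⊥-elim (ℕP.<⇒≱ (ℕP.≤-<-trans i≤q′ q′<q) q≤i)
    bin≉0 : ¬ (bin q′ i ≈ 0#)
    bin≉0 bin≈0 = -1^≉0 i (trans (sym (bin-pred-frob frob i i≤q′)) bin≈0)

-- Write |A| = Qp and x = |A| - 1 - Q. For |A| ≤ j < x + |A| the relation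
-- C(x + |A|, i) S(j) = 0 with i = x + |A| - j ≤ x has a nonzero binomial
-- coefficient, and all power sums it involves at indices ≥ |A| sit below |A| - 1.
module PowerSumGap {c ℓ : Level} (R : CommutativeRing c ℓ) (isField : Poly.IsField R)
                   (p′ : ℕ) (char : Poly.HasCharacteristic R (suc p′))
                   (A : Poly.FiniteAdditiveSubgroup R) where
  open RingArithmetic R
  open Binomials R
  open FrobeniusExponents R
  open PrimeCharacteristic R isField p′ char
  open PowerSums R isField A
  open SubgroupOrder R isField A using (frobenius-card)

  private
    p = suc p′
    q = card A

  private
    gap : ∀ {q′} → q ≡ suc q′ → 1 ℕ.≤ q′ → FrobeniusExponent (suc q′) →
          ∀ j → suc q′ ℕ.≤ j → p ℕ.* (j ∸ q′) ℕ.+ p ℕ.≤ p′ ℕ.* suc q′ → powerSum j ≈ 0#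
    gap {q′} q≡ 1≤q′ frobq j q≤j bound with p∣frobenius (suc q′) (s≤s 1≤q′) frobq
    ... | divides zero    q≡0 = ⊥-elim (ℕP.1+n≢0 q≡0)
    ... | divides (suc Q′) q≡Qp = P.subst (λ m → powerSum m ≈ 0#) (ℕP.m∸[m∸n]≡n (ℕP.<⇒≤ j<k))
            (powerSum≈0 k i vanish (ℕP.m<n⇒0<n∸m j<k) (ℕP.m∸n≤m k j) bin≉0)
      where
      Q = suc Q′
      frobQ : FrobeniusExponent Q
      frobQ = frobenius-/p Q (P.subst FrobeniusExponent q≡Qp frobq)
      Q≤q′ : Q ℕ.≤ q′
      Q≤q′ = ℕP.≤-pred (P.subst (Q ℕ.<_) (P.sym q≡Qp) (ℕP.m<m*n Q p 1<p))
      x = q′ ∸ Q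
      x+Q≡q′ : x ℕ.+ Q ≡ q′
      x+Q≡q′ = ℕP.m∸n+n≡m Q≤q′
      k = x ℕ.+ suc q′
      j<k : j ℕ.< k
      j<k = gap-bound q≡Qp x+Q≡q′ q≤j bound
      i = k ∸ j
      k∸q≡x : k ∸ suc q′ ≡ x
      k∸q≡x = ℕP.m+n∸n≡m x (suc q′)
      x<q′ : x ℕ.< q′
      x<q′ = P.subst (x ℕ.<_) x+Q≡q′ (ℕP.m<m+n x (s≤s z≤n))
      i≤x : i ℕ.≤ x
      i≤x = P.subst (i ℕ.≤_) k∸q≡x (ℕP.∸-monoʳ-≤ k q≤j)
      vanish : ∀ i′ → q ℕ.≤ i′ → i′ ℕ.≤ k → powerSum (k ∸ i′) ≈ 0#
      vanish i′ q≤i′ _ = powerSum-low (k ∸ i′) (P.subst (λ m → k ∸ i′ ℕ.< m ∸ 1) (P.sym q≡)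
        (ℕP.≤-<-trans (P.subst (k ∸ i′ ℕ.≤_) k∸q≡x (ℕP.∸-monoʳ-≤ k (P.subst (ℕ._≤ i′) q≡ q≤i′))) x<q′))
      bin≉0 : ¬ (bin k i ≈ 0#)
      bin≉0 bin≈0 = bin-digits≉0 frobQ frobq x+Q≡q′ q≡Qp i i≤x
        (trans (sym (bin-+-frob-< frobq x i (ℕP.<-trans (ℕP.≤-<-trans i≤x x<q′) (ℕP.n<1+n q′)))) bin≈0)

  powerSum-gap : ∀ j → q ℕ.≤ j → p ℕ.* (j ∸ (q ∸ 1)) ℕ.+ p ℕ.≤ p′ ℕ.* q → powerSum j ≈ 0#
  powerSum-gap j q≤j bound with q in q≡ | frobenius-card
  ... | zero        | _    = ⊥-elim (ℕP.<⇒≱ 1≤q (ℕP.≤-reflexive q≡))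
  ... | suc zero    | _    = ⊥-elim (ℕP.<⇒≱ (ℕP.n<1+n p′)
                                (ℕP.≤-trans (ℕP.m≤n+m p (p ℕ.* j)) (ℕP.≤-trans bound (ℕP.≤-reflexive (ℕP.*-identityʳ p′)))))
  ... | suc (suc q″) | frob = gap q≡ (s≤s z≤n) frob j q≤j bound

module BoxSums {c ℓ : Level} (R : CommutativeRing c ℓ) where
  open RingArithmetic R
  open FiniteSums R
  open import Data.List.Membership.Propositional using (_∈_)
  open import Data.List.Relation.Unary.Unique.Propositional using (Unique)
  open import Data.List.Relation.Unary.All using (All; []; _∷_)
  open import Data.List.Relation.Unary.Any using (here; there)
  open import Data.List.Relation.Unary.AllPairs.Core using ([]; _∷_)
  open import Data.List.Relation.Unary.All.Properties using (All¬⇒¬Any)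

  powerSumProduct : ∀ {n} → Vec ℕ n → Vec (List F) n → F
  powerSumProduct []       []       = 1#
  powerSumProduct (k ∷ ks) (L ∷ Ls) = ∑[ a ← L ] (a ^ k) * powerSumProduct ks Ls

  monomial-boxSum : ∀ {n} (e : Vec ℕ n) (Ls : Vec (List F) n) →
                    ∑[ x ← points Ls ] monomialValue e x ≈ powerSumProduct e Ls
  monomial-boxSum []       []       = +-identityʳ 1#
  monomial-boxSum (k ∷ ks) (L ∷ Ls) = begin
    sumList (List.concatMap (λ a → List.map (a ∷_) (points Ls)) L) (monomialValue (k ∷ ks))
      ≈⟨ sumList-concatMap L (λ a → List.map (a ∷_) (points Ls)) _ ⟩
    ∑[ a ← L ] sumList (List.map (a ∷_) (points Ls)) (monomialValue (k ∷ ks))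
      ≈⟨ sumList-cong L (λ a → trans (sumList-map (points Ls) (a ∷_) _) (sym (sumList-*ˡ (points Ls) (a ^ k) _))) ⟩
    ∑[ a ← L ] (a ^ k * ∑[ x ← points Ls ] monomialValue ks x)
      ≈⟨ sumList-cong L (λ a → *-congˡ (monomial-boxSum ks Ls)) ⟩
    ∑[ a ← L ] (a ^ k * powerSumProduct ks Ls)
      ≈⟨ sym (sumList-*ʳ L (powerSumProduct ks Ls) _) ⟩
    ∑[ a ← L ] (a ^ k) * powerSumProduct ks Ls ∎

  boxSum-terms : ∀ {n} (f : Polynomial n) (Ls : Vec (List F) n) →
                 ∑[ x ← points Ls ] eval f x ≈ ∑[ t ← f ] (proj₁ t * powerSumProduct (proj₂ t) Ls)
  boxSum-terms f Ls = begin
    ∑[ x ← points Ls ] ∑[ t ← f ] (proj₁ t * monomialValue (proj₂ t) x)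
      ≈⟨ sumList-swap (points Ls) f _ ⟩
    ∑[ t ← f ] ∑[ x ← points Ls ] (proj₁ t * monomialValue (proj₂ t) x)
      ≈⟨ sumList-cong f (λ t → trans (sym (sumList-*ˡ (points Ls) (proj₁ t) _)) (*-congˡ (monomial-boxSum (proj₂ t) Ls))) ⟩
    ∑[ t ← f ] (proj₁ t * powerSumProduct (proj₂ t) Ls) ∎

  powerSumProduct-zero : ∀ {n} (e : Vec ℕ n) (Ls : Fin n → List F) i →
                         ∑[ a ← Ls i ] (a ^ Vec.lookup e i) ≈ 0# → powerSumProduct e (Vec.tabulate Ls) ≈ 0#
  powerSumProduct-zero (k ∷ e) Ls zero    S≈0 = x≈0⇒xy≈0 S≈0
  powerSumProduct-zero (k ∷ e) Ls (suc i) S≈0 = y≈0⇒xy≈0 (powerSumProduct-zero e (λ j → Ls (suc j)) i S≈0)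

  module _ {n : ℕ} (M : Vec ℕ n → F) where
    private
      coeff-∷ : ∀ a e′ (f : Polynomial n) e → coeff ((a , e′) ∷ f) e ≈ coeff ((a , e′) ∷ []) e + coeff f e
      coeff-∷ a e′ f e with VecP.≡-dec ℕ._≟_ e′ e
      ... | yes _ = +-congʳ (sym (+-identityʳ a))
      ... | no  _ = sym (+-identityˡ _)

      single-≢ : ∀ a {e′ e : Vec ℕ n} → e′ ≢ e → coeff ((a , e′) ∷ []) e ≈ 0#
      single-≢ a {e′} {e} e′≢e with VecP.≡-dec ℕ._≟_ e′ e
      ... | yes e′≡e = ⊥-elim (e′≢e e′≡e)
      ... | no  _    = refl

      single-≡ : ∀ a (e : Vec ℕ n) → coeff ((a , e) ∷ []) e ≈ a
      single-≡ a e with VecP.≡-dec ℕ._≟_ e e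
      ... | yes _   = +-identityʳ a
      ... | no  e≢e = ⊥-elim (e≢e P.refl)

      sum-none : ∀ a (e′ : Vec ℕ n) {Es} → All (e′ ≢_) Es → ∑[ e ← Es ] (coeff ((a , e′) ∷ []) e * M e) ≈ 0#
      sum-none a e′ []              = refl
      sum-none a e′ (e′≢e ∷ e′∉Es) = trans (+-cong (x≈0⇒xy≈0 (single-≢ a e′≢e)) (sum-none a e′ e′∉Es)) (+-identityˡ 0#)

      sum-single : ∀ a (e′ : Vec ℕ n) {Es} → Unique Es → e′ ∈ Es → ∑[ e ← Es ] (coeff ((a , e′) ∷ []) e * M e) ≈ a * M e′
      sum-single a e′ (e′∉Es ∷ _) (here P.refl) =
        trans (+-cong (*-congʳ (single-≡ a e′)) (sum-none a e′ e′∉Es)) (+-identityʳ _)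
      sum-single a e′ {e ∷ Es} (e∉Es ∷ Es!) (there e′∈Es) =
        trans (+-cong (x≈0⇒xy≈0 (single-≢ a e′≢e)) (sum-single a e′ Es! e′∈Es)) (+-identityˡ _)
        where
        e′≢e : e′ ≢ e
        e′≢e e′≡e = All¬⇒¬Any e∉Es (P.subst (_∈ Es) e′≡e e′∈Es)

    sum-by-coefficients : ∀ (f : Polynomial n) {Es} → Unique Es → All (λ t → proj₂ t ∈ Es) f →
                          ∑[ t ← f ] (proj₁ t * M (proj₂ t)) ≈ ∑[ e ← Es ] (coeff f e * M e)
    sum-by-coefficients []             {Es} _   _               = sym (sumList-zero Es (λ e → zeroˡ (M e)))
    sum-by-coefficients ((a , e′) ∷ f) {Es} Es! (e′∈Es ∷ f⊆Es) = begin
      a * M e′ + ∑[ t ← f ] (proj₁ t * M (proj₂ t))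
        ≈⟨ +-cong (sym (sum-single a e′ Es! e′∈Es)) (sum-by-coefficients f Es! f⊆Es) ⟩
      ∑[ e ← Es ] (coeff ((a , e′) ∷ []) e * M e) + ∑[ e ← Es ] (coeff f e * M e)
        ≈⟨ sym (sumList-+ Es _ _) ⟩
      ∑[ e ← Es ] (coeff ((a , e′) ∷ []) e * M e + coeff f e * M e)
        ≈⟨ sumList-cong Es (λ e → trans (sym (distribʳ _ _ _)) (*-congʳ (sym (coeff-∷ a e′ f e)))) ⟩
      ∑[ e ← Es ] (coeff ((a , e′) ∷ f) e * M e) ∎

module MainTheorem {c ℓ : Level} (R : CommutativeRing c ℓ) (isField : Poly.IsField R)
                   (p′ : ℕ) (char : Poly.HasCharacteristic R (suc p′))
                   (n : ℕ) (A : Fin n → Poly.FiniteAdditiveSubgroup R) where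
  open RingArithmetic R
  open FiniteSums R
  open BoxSums R
  open import Data.List.Membership.Propositional.Properties using (∈-map⁺; ∈-deduplicate⁺)
  open import Data.List.Relation.Unary.Unique.DecPropositional.Properties using (deduplicate-!)
  import Data.List.Relation.Unary.All as All

  private
    p = suc p′
    q : Fin n → ℕ
    q i = card (A i)
    target = Vec.tabulate (λ i → q i ∸ 1)
    boxes = Vec.tabulate (λ i → elems (A i))

  DegreeOk : ℕ → Set
  DegreeOk d = p ℕ.* d ℕ.+ p ℕ.≤ p ℕ.* sumFin n (λ i → q i ∸ 1) ℕ.+ (p ∸ 1) ℕ.* minFin n q

  DegreeOk? : ∀ d → Dec (DegreeOk d)
  DegreeOk? d = _ ℕ.≤? _

  powerSumProduct≈0 : ∀ e → DegreeOk (totalDeg e) → e ≢ target → powerSumProduct e boxes ≈ 0#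
  powerSumProduct≈0 e ok e≢target with exponent-trichotomy e (λ i → q i ∸ 1)
  ... | inj₁ e≡target                = ⊥-elim (e≢target e≡target)
  ... | inj₂ (inj₁ (i , low))         =
    powerSumProduct-zero e (λ i → elems (A i)) i (PowerSums.powerSum-low R isField (A i) (Vec.lookup e i) low)
  ... | inj₂ (inj₂ (above , i , high)) =
    powerSumProduct-zero e (λ i → elems (A i)) i (PowerSumGap.powerSum-gap R isField p′ char (A i) (Vec.lookup e i) qᵢ≤eᵢ bound)
    where
    qᵢ≤eᵢ : q i ℕ.≤ Vec.lookup e i
    qᵢ≤eᵢ = ℕP.≤-trans (ℕP.m≤n+m∸n (q i) 1) high
    excess≤deg : sumFin n (λ j → q j ∸ 1) ℕ.+ (Vec.lookup e i ∸ (q i ∸ 1)) ℕ.≤ totalDeg e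
    excess≤deg = P.subst (sumFin n (λ j → q j ∸ 1) ℕ.+ (Vec.lookup e i ∸ (q i ∸ 1)) ℕ.≤_) (P.sym (totalDeg≡sumFin e)) (sumFin-excess n above i)
    bound = excess-bound p′ _ (totalDeg e) _ _ (q i) ok excess≤deg (minFin≤ n q i)

  boxSum≈0 : (f : Polynomial n) → DegreeBounded f DegreeOk → coeff f target ≈ 0# → boxSum f A ≈ 0#
  boxSum≈0 f deg top = begin
    boxSum f A                                              ≈⟨ boxSum-terms f boxes ⟩
    ∑[ t ← f ] (proj₁ t * powerSumProduct (proj₂ t) boxes)  ≈⟨ sum-by-coefficients M f (deduplicate-! _ exponents) f⊆Es ⟩
    ∑[ e ← Es ] (coeff f e * M e)                           ≈⟨ sumList-zero Es term≈0 ⟩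
    0#                                                      ∎
    where
    M : Vec ℕ n → F
    M e = powerSumProduct e boxes
    exponents = List.map proj₂ f
    Es = List.deduplicate (VecP.≡-dec ℕ._≟_) exponents
    f⊆Es = All.tabulate (λ t∈f → ∈-deduplicate⁺ (VecP.≡-dec ℕ._≟_) (∈-map⁺ proj₂ t∈f))
    term≈0 : ∀ e → coeff f e * M e ≈ 0#
    term≈0 e with DegreeOk? (totalDeg e) | VecP.≡-dec ℕ._≟_ e target
    ... | no ¬ok | _          = x≈0⇒xy≈0 (deg e ¬ok)
    ... | yes _  | yes P.refl = x≈0⇒xy≈0 top
    ... | yes ok | no e≢target = y≈0⇒xy≈0 (powerSumProduct≈0 e ok e≢target)

open import Data.Nat using (_+_; _*_; _≤_; _<_)
open import Data.Vec using (tabulate)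

corollary6p7 : {c ℓ : Level} (R : CommutativeRing c ℓ) → Poly.IsField R →
    (p : ℕ) → 0 < p → Poly.HasCharacteristic R p →
    (n : ℕ) → 1 ≤ n → (A : Fin n → Poly.FiniteAdditiveSubgroup R) →
    (f : Poly.Polynomial R n) →
    Poly.DegreeBounded R f (λ d → p * d + p ≤ p * sumFin n (λ i → Poly.card R (A i) ∸ 1) + (p ∸ 1) * minFin n (λ i → Poly.card R (A i))) →
    CommutativeRing._≈_ R (Poly.coeff R f (tabulate (λ i → Poly.card R (A i) ∸ 1))) (CommutativeRing.0# R) →
    CommutativeRing._≈_ R (Poly.boxSum R f A) (CommutativeRing.0# R)
corollary6p7 R isField zero     ()  char n _ A f
corollary6p7 R isField (suc p′) _   char n _ A f = MainTheorem.boxSum≈0 R isField p′ char n A f
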